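{- Let $k \geq 0$ and let $G$ be a cubic graph. If $G$ has a bipartite $k$-core $G_c$, then $G$ has an even 4-cycle cover of length at most $\frac{4}{3}|E(G)| + \frac{2}{3}k$. In particular, if $G_c$ is cyclic, then $G$ has an even 3-cycle cover of length at most $\frac{4}{3}|E(G)| + \frac{2}{3}k$.
   Context: Graphs are finite, may have parallel edges, but no loops. A 1-factor is a spanning 1-regular subgraph, identified with its edge set. For $X\subseteq E(G)$, $G[X]$ is the graph with edge set $X$ and vertex set all endpoints of edges of $X$. For three pairwise different 1-factors $M_1,M_2,M_3$ of a cubic graph $G$, let $\mathcal{M} = \bigcup_{i\neq j}(M_i\cap M_j)$ and $\mathcal{U} = E(G) - (M_1\cup M_2\cup M_3)$; if $|\mathcal{U}|=k$, then $G[\mathcal{M}\cup\mathcal{U}]$ is the $k$-core of $G$ with respect to $M_1,M_2,M_3$. A core is cyclic if it is a cycle, i.e. all its vertices have even degree (equivalently it is 2-regular). A cycle is a subgraph all of whose vertices have even degree; in a cubic graph it is a disjoint union of circuits, and it is even if all these circuits have even length. An $l$-cycle cover is a set of at most $l$ cycles covering every edge at least once; it is even if all its cycles are even; its length is $\sum_C |E(C)|$. -}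

module Defs where

open import Data.Nat using (ℕ; zero; suc; _+_; _*_; _≤_)
open import Data.Nat.Divisibility using (_∣_)
open import Data.Nat.DivMod using (_mod_)
open import Data.Bool using (Bool; true; false; _∧_; _∨_; not)
open import Data.Fin using (Fin; toℕ; _≟_)
open import Data.Product using (Σ; _×_; _,_; proj₁; proj₂)
open import Data.Sum using (_⊎_)
open import Data.List using (List; length; map)
open import Data.Nat.ListAction using (sum)
open import Data.List.Relation.Unary.Any using (Any)
open import Relation.Nullary using (¬_)
open import Relation.Nullary.Decidable using (⌊_⌋)
open import Relation.Binary.PropositionalEquality using (_≡_; _≢_)
open import Function.Definitions using (Injective)

-- A finite multigraph without loops: vertices Fin n, edges Fin m,
-- each edge has an (ordered, for bookkeeping) pair of distinct endpoints.
record Graph : Set where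
  field
    n    : ℕ
    m    : ℕ
    ends : Fin m → Fin n × Fin n
    loopless : ∀ e → proj₁ (ends e) ≢ proj₂ (ends e)
open Graph public

EdgeSet : Graph → Set
EdgeSet G = Fin (m G) → Bool

count : ∀ {k} → (Fin k → Bool) → ℕ
count {zero}  f = 0
count {suc k} f with f Fin.zero
... | true  = suc (count (λ i → f (Fin.suc i)))
... | false = count (λ i → f (Fin.suc i))

size : (G : Graph) → EdgeSet G → ℕ
size G X = count X

incident : (G : Graph) → Fin (m G) → Fin (n G) → Bool
incident G e v = ⌊ v ≟ proj₁ (ends G e) ⌋ ∨ ⌊ v ≟ proj₂ (ends G e) ⌋

deg : (G : Graph) → EdgeSet G → Fin (n G) → ℕ
deg G X v = count (λ e → X e ∧ incident G e v)

allEdges : (G : Graph) → EdgeSet G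
allEdges G e = true

Cubic : Graph → Set
Cubic G = ∀ v → deg G (allEdges G) v ≡ 3

OneFactor : (G : Graph) → EdgeSet G → Set
OneFactor G M = ∀ v → deg G M v ≡ 1

SameSet : (G : Graph) → EdgeSet G → EdgeSet G → Set
SameSet G X Y = ∀ e → X e ≡ Y e

coreM : (G : Graph) → (M₁ M₂ M₃ : EdgeSet G) → EdgeSet G
coreM G M₁ M₂ M₃ e = (M₁ e ∧ M₂ e) ∨ (M₁ e ∧ M₃ e) ∨ (M₂ e ∧ M₃ e)

coreU : (G : Graph) → (M₁ M₂ M₃ : EdgeSet G) → EdgeSet G
coreU G M₁ M₂ M₃ e = not (M₁ e ∨ M₂ e ∨ M₃ e)

coreEdges : (G : Graph) → (M₁ M₂ M₃ : EdgeSet G) → EdgeSet G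
coreEdges G M₁ M₂ M₃ e = coreM G M₁ M₂ M₃ e ∨ coreU G M₁ M₂ M₃ e

Bipartite : (G : Graph) → EdgeSet G → Set
Bipartite G X = Σ (Fin (n G) → Bool) λ c →
  ∀ e → X e ≡ true → c (proj₁ (ends G e)) ≢ c (proj₂ (ends G e))

-- a cycle: every vertex has even degree in G[X]
IsCycle : (G : Graph) → EdgeSet G → Set
IsCycle G X = ∀ v → 2 ∣ deg G X v

Joins : (G : Graph) → Fin (m G) → Fin (n G) → Fin (n G) → Set
Joins G e u v = (ends G e ≡ (u , v)) ⊎ (ends G e ≡ (v , u))

next : ∀ {l} → Fin (suc l) → Fin (suc l)
next {l} i = suc (toℕ i) mod suc l

-- A circuit of length (suc l) (≥ 2, parallel edges give circuits of length 2):
-- distinct vertices vs 0..l and distinct edges es i joining vs i and vs (i+1 mod (l+1)).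
record Circuit (G : Graph) (l : ℕ) : Set where
  field
    nontrivial : 1 ≤ l
    vs  : Fin (suc l) → Fin (n G)
    es  : Fin (suc l) → Fin (m G)
    vs-inj : Injective _≡_ _≡_ vs
    es-inj : Injective _≡_ _≡_ es
    joins  : ∀ i → Joins G (es i) (vs i) (vs (next i))
open Circuit public

-- an even cycle: a cycle all of whose circuits have even length
-- (in a cubic graph the circuits contained in a cycle are exactly its components)
IsEvenCycle : (G : Graph) → EdgeSet G → Set
IsEvenCycle G X = IsCycle G X ×
  (∀ l → (Z : Circuit G l) → (∀ i → X (es Z i) ≡ true) → 2 ∣ suc l)

IsEvenCycleCover : (G : Graph) → ℕ → List (EdgeSet G) → Set
IsEvenCycleCover G l Cs =
  (length Cs ≤ l) ×
  (∀ C → Data.List.Membership.Propositional._∈_ C Cs → IsEvenCycle G C) ×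
  (∀ e → Any (λ C → C e ≡ true) Cs)
  where import Data.List.Membership.Propositional

coverLength : (G : Graph) → List (EdgeSet G) → ℕ
coverLength G Cs = sum (map (size G) Cs)

-- G has an even l-cycle cover of length at most (4/3)|E(G)| + (2/3)k,
-- written over ℕ as 3 · length ≤ 4 |E(G)| + 2 k
HasShortEvenCover : (G : Graph) → (l k : ℕ) → Set
HasShortEvenCover G l k = Σ (List (EdgeSet G)) λ Cs →
  IsEvenCycleCover G l Cs × (3 * coverLength G Cs ≤ 4 * m G + 2 * k)

module Submission where

-- Let A, B, T and U be the edges lying in exactly one, two, three and none of M₁, M₂, M₃, of
-- sizes a, b, t and u. Then |E| = a + b + t + u, and as every Mᵢ has |E|/3 edges, u = b + 2t.
-- The symmetric differences Mᵢ ∆ Mⱼ are even cycles of total length 2(a + b); the two shortest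
-- have length at most (4/3)(a + b) and together with the core T ∪ B ∪ U they cover all edges.
-- A cyclic core is even, being bipartite, and completes a 3-cycle cover. In general Q = B ∪ U is
-- a disjoint union of even circuits, so it has a perfect matching N; with X = N ∆ B the sets
-- T ∪ X and T ∪ (Q ∖ X) are even cycles covering the core with total length 2t + b + u.
-- Both length bounds then follow from u = b + 2t.

open import Defs
open import Data.Nat using (ℕ; zero; suc; _+_; _*_; _≤_; _<_; _<?_; _≤?_; _≡ᵇ_; z≤n; s≤s)
open import Data.Nat.Properties hiding (_≟_)
open import Data.Nat.Properties using () renaming (_≟_ to _≟ℕ_)
open import Data.Nat.DivMod using (_%_; _mod_; m%n<n; %-distribˡ-+; m%n%n≡m%n; n%n≡0; m<n⇒m%n≡m)
open import Data.Nat.Divisibility using (_∣_; divides; _∣0; ∣-refl; ∣m∣n⇒∣m+n; ∣m+n∣m⇒∣n)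
open import Data.Nat.ListAction using (sum)
open import Data.Nat.Tactic.RingSolver using (solve-∀)
open import Data.Bool using (Bool; true; false; _∧_; _∨_; not; _xor_; if_then_else_)
open import Data.Bool.Properties
  using (T-≡; not-injective; not-involutive; ¬-not; ∧-distribʳ-∨; ∧-identityʳ; ∧-zeroʳ; ∨-identityʳ; ∨-zeroʳ;
         xor-identityʳ; not-distribʳ-xor)
open import Data.Bool.ListAction using (any)
open import Data.Fin using (Fin; toℕ; fromℕ<; _≟_)
import Data.Fin as Fin
open import Data.Fin.Properties using (toℕ-injective; toℕ-fromℕ<; toℕ<n)
import Data.Fin.Properties as Fin
open import Data.Product using (Σ; _×_; _,_; proj₁; proj₂)
open import Data.Sum using (_⊎_; inj₁; inj₂; [_,_]′)
open import Data.Empty using (⊥; ⊥-elim)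
open import Data.List using (List; []; _∷_; map; length)
open import Data.List.Relation.Unary.All as All using (All; []; _∷_)
open import Data.List.Relation.Unary.Any as Any using (Any; here; there)
open import Data.List.Relation.Unary.Any.Properties using (any⁻)
open import Function using (_∘_; id; const; case_of_)
open import Function.Bundles using (Equivalence)
open import Relation.Nullary using (¬_; Dec; yes; no; contradiction)
open import Relation.Nullary.Decidable using (⌊_⌋; isYes≗does; dec-true; dec-false; ⌊⌋-map′; decidable-stable)
open import Relation.Binary.PropositionalEquality

_⊆_ : ∀ {A : Set} → (A → Bool) → (A → Bool) → Set
X ⊆ Y = ∀ e → X e ≡ true → Y e ≡ true

Disjoint : ∀ {A : Set} → (A → Bool) → (A → Bool) → Set
Disjoint X Y = ∀ e → X e ≡ true → Y e ≡ true → ⊥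

χ : Bool → ℕ
χ true  = 1
χ false = 0

χ-∧ : ∀ x y → χ (x ∧ y) ≡ χ x * χ y
χ-∧ false y = refl
χ-∧ true  y = sym (+-identityʳ (χ y))

χ-mono : ∀ {x y} → (x ≡ true → y ≡ true) → χ x ≤ χ y
χ-mono {false} _   = z≤n
χ-mono {true}  x⇒y rewrite x⇒y refl = ≤-refl

χ≡ᵇ1 : ∀ b → (χ b ≡ᵇ 1) ≡ b
χ≡ᵇ1 true  = refl
χ≡ᵇ1 false = refl

∧-intro : ∀ {a b} → a ≡ true → b ≡ true → (a ∧ b) ≡ true
∧-intro refl refl = refl

∧-elimˡ : ∀ {a b} → (a ∧ b) ≡ true → a ≡ true
∧-elimˡ {true} _ = refl

∧-elimʳ : ∀ a {b} → (a ∧ b) ≡ true → b ≡ true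
∧-elimʳ true b≡true = b≡true

∨-introˡ : ∀ {a} b → a ≡ true → (a ∨ b) ≡ true
∨-introˡ b refl = refl

∨-introʳ : ∀ a {b} → b ≡ true → (a ∨ b) ≡ true
∨-introʳ false refl = refl
∨-introʳ true  refl = refl

⊆-false : ∀ {A : Set} {f g : A → Bool} → f ⊆ g → ∀ {i} → g i ≡ false → f i ≡ false
⊆-false {f = f} f⊆g {i} gi≡false with f i in fi
... | false = refl
... | true  = trans (sym (f⊆g i fi)) gi≡false

≢-complements : ∀ {a a' b b' : Bool} → a ≢ a' → b ≢ b' → a' ≢ b' → a ≢ b
≢-complements a≢a' b≢b' a'≢b' a≡b =
  a'≢b' (trans (¬-not (≢-sym a≢a')) (trans (cong not a≡b) (sym (¬-not (≢-sym b≢b')))))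

xor-cancelʳ : ∀ {a b} t → a xor t ≡ b xor t → a ≡ b
xor-cancelʳ {false} {false} t     _  = refl
xor-cancelʳ {true}  {true}  t     _  = refl
xor-cancelʳ {false} {true}  false ()
xor-cancelʳ {false} {true}  true  ()
xor-cancelʳ {true}  {false} false ()
xor-cancelʳ {true}  {false} true  ()

xor-not-swap : ∀ {a b} t → a ≢ b → a xor not t ≡ b xor t
xor-not-swap {false} {false} t a≢b = ⊥-elim (a≢b refl)
xor-not-swap {false} {true}  t _   = refl
xor-not-swap {true}  {false} t _   = not-involutive t
xor-not-swap {true}  {true}  t a≢b = ⊥-elim (a≢b refl)

xor-≢-agree : ∀ {a b s t} → a ≢ b → a xor s ≢ b xor t → s ≡ t
xor-≢-agree {false} {false} a≢b _ = ⊥-elim (a≢b refl)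
xor-≢-agree {true}  {true}  a≢b _ = ⊥-elim (a≢b refl)
xor-≢-agree {false} {true}  {s} {t} _ s≢¬t   = trans (¬-not s≢¬t) (not-involutive t)
xor-≢-agree {true}  {false} {s} {t} _ ¬s≢t   = not-injective (¬-not ¬s≢t)

⌊⌋-true : ∀ {P : Set} (d : Dec P) → P → ⌊ d ⌋ ≡ true
⌊⌋-true d p = trans (isYes≗does d) (dec-true d p)

⌊⌋-false : ∀ {P : Set} (d : Dec P) → ¬ P → ⌊ d ⌋ ≡ false
⌊⌋-false d ¬p = trans (isYes≗does d) (dec-false d ¬p)

⌊⌋-sound : ∀ {P : Set} (d : Dec P) → ⌊ d ⌋ ≡ true → P
⌊⌋-sound (yes p) _ = p

∑ : ∀ {k} → (Fin k → ℕ) → ℕ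
∑ {zero}  f = 0
∑ {suc k} f = f Fin.zero + ∑ (f ∘ Fin.suc)

∑-cong : ∀ {k} {f g : Fin k → ℕ} → (∀ i → f i ≡ g i) → ∑ f ≡ ∑ g
∑-cong {zero}  _   = refl
∑-cong {suc k} f≗g = cong₂ _+_ (f≗g Fin.zero) (∑-cong (f≗g ∘ Fin.suc))

∑-const : ∀ k c → ∑ {k} (const c) ≡ k * c
∑-const zero    c = refl
∑-const (suc k) c = cong (c +_) (∑-const k c)

∑-distrib-+ : ∀ {k} (f g : Fin k → ℕ) → ∑ (λ i → f i + g i) ≡ ∑ f + ∑ g
∑-distrib-+ {zero}  f g = refl
∑-distrib-+ {suc k} f g =
  begin
    f₀ + g₀ + ∑ (λ i → f (Fin.suc i) + g (Fin.suc i))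
  ≡⟨ cong (f₀ + g₀ +_) (∑-distrib-+ (f ∘ Fin.suc) (g ∘ Fin.suc)) ⟩
    f₀ + g₀ + (∑ (f ∘ Fin.suc) + ∑ (g ∘ Fin.suc))
  ≡⟨ +-interchange f₀ g₀ _ _ ⟩
    f₀ + ∑ (f ∘ Fin.suc) + (g₀ + ∑ (g ∘ Fin.suc))
  ∎
  where
  open ≡-Reasoning
  f₀ = f Fin.zero
  g₀ = g Fin.zero
  +-interchange : ∀ a b c d → a + b + (c + d) ≡ a + c + (b + d)
  +-interchange = solve-∀

*-distribˡ-∑ : ∀ {k} c (f : Fin k → ℕ) → ∑ (λ i → c * f i) ≡ c * ∑ f
*-distribˡ-∑ {zero}  c f = sym (*-zeroʳ c)
*-distribˡ-∑ {suc k} c f =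
  trans (cong (c * f Fin.zero +_) (*-distribˡ-∑ c (f ∘ Fin.suc)))
        (sym (*-distribˡ-+ c (f Fin.zero) _))

∑-comm : ∀ {k l} (f : Fin k → Fin l → ℕ) →
         ∑ (λ i → ∑ (λ j → f i j)) ≡ ∑ (λ j → ∑ (λ i → f i j))
∑-comm {zero}  {l} f = sym (trans (∑-const l 0) (*-zeroʳ l))
∑-comm {suc k} f =
  trans (cong (∑ (f Fin.zero) +_) (∑-comm (f ∘ Fin.suc)))
        (sym (∑-distrib-+ (f Fin.zero) (λ j → ∑ (λ i → f (Fin.suc i) j))))

∑-mono : ∀ {k} {f g : Fin k → ℕ} → (∀ i → f i ≤ g i) → ∑ f ≤ ∑ g
∑-mono {zero}  _   = z≤n
∑-mono {suc k} f≤g = +-mono-≤ (f≤g Fin.zero) (∑-mono (f≤g ∘ Fin.suc))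

count≡∑χ : ∀ {k} (f : Fin k → Bool) → count f ≡ ∑ (χ ∘ f)
count≡∑χ {zero}  f = refl
count≡∑χ {suc k} f with f Fin.zero
... | true  = cong suc (count≡∑χ (f ∘ Fin.suc))
... | false = count≡∑χ (f ∘ Fin.suc)

count-cong : ∀ {k} {f g : Fin k → Bool} → (∀ i → f i ≡ g i) → count f ≡ count g
count-cong {f = f} {g} f≗g =
  trans (count≡∑χ f) (trans (∑-cong (cong χ ∘ f≗g)) (sym (count≡∑χ g)))

count-mono : ∀ {k} {f g : Fin k → Bool} → f ⊆ g → count f ≤ count g
count-mono {f = f} {g} f⊆g =
  subst₂ _≤_ (sym (count≡∑χ f)) (sym (count≡∑χ g)) (∑-mono (χ-mono ∘ f⊆g))

count-const : ∀ k b → count {k} (const b) ≡ k * χ b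
count-const k b = trans (count≡∑χ {k} (const b)) (∑-const k (χ b))

count-+ : ∀ {k} (f g h : Fin k → Bool) → (∀ i → χ (f i) + χ (g i) ≡ χ (h i)) → count f + count g ≡ count h
count-+ f g h pointwise = begin
  count f + count g              ≡⟨ cong₂ _+_ (count≡∑χ f) (count≡∑χ g) ⟩
  ∑ (χ ∘ f) + ∑ (χ ∘ g)          ≡⟨ ∑-distrib-+ (χ ∘ f) (χ ∘ g) ⟨
  ∑ (λ i → χ (f i) + χ (g i))    ≡⟨ ∑-cong pointwise ⟩
  ∑ (χ ∘ h)                      ≡⟨ count≡∑χ h ⟨
  count h                        ∎
  where open ≡-Reasoning

count-disjoint-∨ : ∀ {k} (f g : Fin k → Bool) → Disjoint f g → count (λ i → f i ∨ g i) ≡ count f + count g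
count-disjoint-∨ f g disjoint = sym (count-+ f g _ (λ i → χ-∨ (f i) (g i) (disjoint i)))
  where
  χ-∨ : ∀ x y → (x ≡ true → y ≡ true → ⊥) → χ x + χ y ≡ χ (x ∨ y)
  χ-∨ false y    _   = refl
  χ-∨ true  false _  = refl
  χ-∨ true  true x∧y = ⊥-elim (x∧y refl refl)

count-singleton : ∀ {k} (a : Fin k) → count (λ i → ⌊ i ≟ a ⌋) ≡ 1
count-singleton {suc k} Fin.zero =
  cong suc (trans (count-cong {k} (λ i → ⌊⌋-false (Fin.suc i ≟ Fin.zero) (λ ()))) (trans (count-const k false) (*-zeroʳ k)))
count-singleton {suc k} (Fin.suc a) =
  trans (count-cong (λ i → ⌊⌋-map′ (cong Fin.suc) Fin.suc-injective (i ≟ a))) (count-singleton a)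

count-singleton-∧ : ∀ {k} (a : Fin k) (β : Fin k → Bool) → count (λ i → ⌊ i ≟ a ⌋ ∧ β i) ≡ χ (β a)
count-singleton-∧ {k} a β = trans (count-cong only-a) (count-at-a (β a))
  where
  only-a : ∀ i → (⌊ i ≟ a ⌋ ∧ β i) ≡ (⌊ i ≟ a ⌋ ∧ β a)
  only-a i with i ≟ a
  ... | yes refl = refl
  ... | no  _    = refl
  count-at-a : ∀ b → count (λ i → ⌊ i ≟ a ⌋ ∧ b) ≡ χ b
  count-at-a true  = trans (count-cong {k} (λ i → ∧-identityʳ _)) (count-singleton a)
  count-at-a false = trans (count-cong {k} (λ i → ∧-zeroʳ _)) (trans (count-const k false) (*-zeroʳ k))

count-pair : ∀ {k} {a b : Fin k} → a ≢ b → count (λ i → ⌊ i ≟ a ⌋ ∨ ⌊ i ≟ b ⌋) ≡ 2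
count-pair {a = a} {b} a≢b =
  trans (count-disjoint-∨ _ _ (λ i i≡a i≡b → a≢b (trans (sym (⌊⌋-sound (i ≟ a) i≡a)) (⌊⌋-sound (i ≟ b) i≡b))))
        (cong₂ _+_ (count-singleton a) (count-singleton b))

2≤count : ∀ {k} (f : Fin k → Bool) {a b : Fin k} → a ≢ b → f a ≡ true → f b ≡ true → 2 ≤ count f
2≤count f {a} {b} a≢b fa fb = subst (_≤ count f) (count-pair a≢b) (count-mono pair⊆f)
  where
  pair⊆f : ∀ i → (⌊ i ≟ a ⌋ ∨ ⌊ i ≟ b ⌋) ≡ true → f i ≡ true
  pair⊆f i _ with i ≟ a | i ≟ b
  pair⊆f i _ | yes refl | _        = fa
  pair⊆f i _ | no _     | yes refl = fb

≤1⇒0⊎1 : ∀ {d} → d ≤ 1 → d ≡ 0 ⊎ d ≡ 1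
≤1⇒0⊎1 z≤n       = inj₁ refl
≤1⇒0⊎1 (s≤s z≤n) = inj₂ refl

≤2⇒≤1⊎≡2 : ∀ {d} → d ≤ 2 → d ≤ 1 ⊎ d ≡ 2
≤2⇒≤1⊎≡2 z≤n             = inj₁ z≤n
≤2⇒≤1⊎≡2 (s≤s z≤n)       = inj₁ (s≤s z≤n)
≤2⇒≤1⊎≡2 (s≤s (s≤s z≤n)) = inj₂ refl

_∩_ : ∀ {k} → (Fin k → Bool) → (Fin k → Bool) → Fin k → Bool
(X ∩ Y) e = X e ∧ Y e

_∪_ : ∀ {k} → (Fin k → Bool) → (Fin k → Bool) → Fin k → Bool
(X ∪ Y) e = X e ∨ Y e

_∖_ : ∀ {k} → (Fin k → Bool) → (Fin k → Bool) → Fin k → Bool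
(X ∖ Y) e = X e ∧ not (Y e)

_∆_ : ∀ {k} → (Fin k → Bool) → (Fin k → Bool) → Fin k → Bool
(X ∆ Y) e = X e xor Y e

∨-elim : ∀ a {b} → (a ∨ b) ≡ true → a ≡ true ⊎ b ≡ true
∨-elim true  _ = inj₁ refl
∨-elim false b = inj₂ b

∪-⊆ : ∀ {k} {X Y Z : Fin k → Bool} → X ⊆ Z → Y ⊆ Z → (X ∪ Y) ⊆ Z
∪-⊆ {X = X} X⊆Z Y⊆Z e e∈X∪Y = [ X⊆Z e , Y⊆Z e ]′ (∨-elim (X e) e∈X∪Y)

∆-⊆ : ∀ {k} {X Y Z : Fin k → Bool} → X ⊆ Z → Y ⊆ Z → (X ∆ Y) ⊆ Z
∆-⊆ {X = X} X⊆Z Y⊆Z e e∈X∆Y = [ X⊆Z e , Y⊆Z e ]′ (xor-elim (X e) e∈X∆Y)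
  where
  xor-elim : ∀ a {b} → (a xor b) ≡ true → a ≡ true ⊎ b ≡ true
  xor-elim true  _ = inj₁ refl
  xor-elim false b = inj₂ b

addIf : ∀ {k} → Bool → Fin k → (Fin k → Bool) → Fin k → Bool
addIf b a X i = X i ∨ (b ∧ ⌊ i ≟ a ⌋)

-- With ι = star G v this is deg G X v, with ι = const true it is size G X.
count⟨_⟩ : ∀ {k} → (Fin k → Bool) → (Fin k → Bool) → ℕ
count⟨ ι ⟩ X = count (λ e → X e ∧ ι e)

star : (G : Graph) → Fin (n G) → EdgeSet G
star G v e = incident G e v

count⟨true⟩ : ∀ {k} (X : Fin k → Bool) → count⟨ const true ⟩ X ≡ count X
count⟨true⟩ X = count-cong (λ e → ∧-identityʳ (X e))

count⟨⟩-cong : ∀ {k} {X Y : Fin k → Bool} → (∀ e → X e ≡ Y e) → ∀ ι → count⟨ ι ⟩ X ≡ count⟨ ι ⟩ Y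
count⟨⟩-cong X≗Y ι = count-cong (λ e → cong (_∧ ι e) (X≗Y e))

multiplicity : ∀ {k} → List (Fin k → Bool) → Fin k → ℕ
multiplicity Xs e = sum (map (λ X → χ (X e)) Xs)

∑count⟨⟩≡∑multiplicity : ∀ {k} (ι : Fin k → Bool) (Xs : List (Fin k → Bool)) →
  sum (map count⟨ ι ⟩ Xs) ≡ ∑ (λ e → multiplicity Xs e * χ (ι e))
∑count⟨⟩≡∑multiplicity {k} ι [] = sym (trans (∑-const k 0) (*-zeroʳ k))
∑count⟨⟩≡∑multiplicity {k} ι (X ∷ Xs) =
  begin
    count⟨ ι ⟩ X + sum (map count⟨ ι ⟩ Xs)
  ≡⟨ cong₂ _+_ (trans (count≡∑χ {k} _) (∑-cong (λ e → χ-∧ (X e) (ι e)))) (∑count⟨⟩≡∑multiplicity ι Xs) ⟩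
    ∑ (λ e → χ (X e) * χ (ι e)) + ∑ (λ e → multiplicity Xs e * χ (ι e))
  ≡⟨ sym (∑-distrib-+ {k} _ _) ⟩
    ∑ (λ e → χ (X e) * χ (ι e) + multiplicity Xs e * χ (ι e))
  ≡⟨ ∑-cong (λ e → sym (*-distribʳ-+ (χ (ι e)) (χ (X e)) _)) ⟩
    ∑ (λ e → multiplicity (X ∷ Xs) e * χ (ι e))
  ∎
  where open ≡-Reasoning

same-multiplicity⇒same-count : ∀ {k} (Xs Ys : List (Fin k → Bool)) →
  (∀ e → multiplicity Xs e ≡ multiplicity Ys e) →
  ∀ ι → sum (map count⟨ ι ⟩ Xs) ≡ sum (map count⟨ ι ⟩ Ys)
same-multiplicity⇒same-count Xs Ys same ι =
  trans (∑count⟨⟩≡∑multiplicity ι Xs)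
        (trans (∑-cong (λ e → cong (_* χ (ι e)) (same e))) (sym (∑count⟨⟩≡∑multiplicity ι Ys)))

count⟨⟩-∪ : ∀ {k} {X Y : Fin k → Bool} → Disjoint X Y → ∀ ι → count⟨ ι ⟩ (X ∪ Y) ≡ count⟨ ι ⟩ X + count⟨ ι ⟩ Y
count⟨⟩-∪ {X = X} {Y} disjoint ι =
  trans (sym (+-identityʳ _))
        (trans (same-multiplicity⇒same-count ((X ∪ Y) ∷ []) (X ∷ Y ∷ []) multiplicities ι)
               (cong (count⟨ ι ⟩ X +_) (+-identityʳ _)))
  where
  multiplicities : ∀ e → multiplicity ((X ∪ Y) ∷ []) e ≡ multiplicity (X ∷ Y ∷ []) e
  multiplicities e with X e in Xe | Y e in Ye
  ... | false | _     = refl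
  ... | true  | false = refl
  ... | true  | true  = ⊥-elim (disjoint e Xe Ye)

count⟨⟩-∆ : ∀ {k} (X Y : Fin k → Bool) ι →
  count⟨ ι ⟩ (X ∩ Y) + (count⟨ ι ⟩ (X ∩ Y) + count⟨ ι ⟩ (X ∆ Y)) ≡ count⟨ ι ⟩ X + count⟨ ι ⟩ Y
count⟨⟩-∆ X Y ι = begin
  count⟨ ι ⟩ (X ∩ Y) + (count⟨ ι ⟩ (X ∩ Y) + count⟨ ι ⟩ (X ∆ Y))
    ≡⟨ cong (λ d → count⟨ ι ⟩ (X ∩ Y) + (count⟨ ι ⟩ (X ∩ Y) + d)) (+-identityʳ _) ⟨
  sum (map count⟨ ι ⟩ ((X ∩ Y) ∷ (X ∩ Y) ∷ (X ∆ Y) ∷ []))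
    ≡⟨ same-multiplicity⇒same-count (_ ∷ _ ∷ _ ∷ []) (X ∷ Y ∷ []) multiplicities ι ⟩
  count⟨ ι ⟩ X + (count⟨ ι ⟩ Y + 0)
    ≡⟨ cong (count⟨ ι ⟩ X +_) (+-identityʳ _) ⟩
  count⟨ ι ⟩ X + count⟨ ι ⟩ Y
    ∎
  where
  open ≡-Reasoning
  multiplicities : ∀ e → multiplicity ((X ∩ Y) ∷ (X ∩ Y) ∷ (X ∆ Y) ∷ []) e ≡ multiplicity (X ∷ Y ∷ []) e
  multiplicities e with X e | Y e
  ... | false | false = refl
  ... | false | true  = refl
  ... | true  | false = refl
  ... | true  | true  = refl

count⟨⟩-split : ∀ {k} {T Q X : Fin k → Bool} → Disjoint T Q → X ⊆ Q → ∀ ι →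
  count⟨ ι ⟩ (T ∪ X) + count⟨ ι ⟩ (T ∪ (Q ∖ X)) ≡ count⟨ ι ⟩ T + (count⟨ ι ⟩ T + count⟨ ι ⟩ Q)
count⟨⟩-split {T = T} {Q} {X} disjoint X⊆Q ι =
  trans (cong (count⟨ ι ⟩ (T ∪ X) +_) (sym (+-identityʳ _)))
        (trans (same-multiplicity⇒same-count ((T ∪ X) ∷ (T ∪ (Q ∖ X)) ∷ []) (T ∷ T ∷ Q ∷ []) multiplicities ι)
               (cong (λ d → count⟨ ι ⟩ T + (count⟨ ι ⟩ T + d)) (+-identityʳ _)))
  where
  multiplicities : ∀ e → multiplicity ((T ∪ X) ∷ (T ∪ (Q ∖ X)) ∷ []) e ≡ multiplicity (T ∷ T ∷ Q ∷ []) e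
  multiplicities e with T e in Te | Q e in Qe | X e in Xe
  ... | true  | true  | _     = ⊥-elim (disjoint e Te Qe)
  ... | true  | false | _     = refl
  ... | false | true  | true  = refl
  ... | false | true  | false = refl
  ... | false | false | false = refl
  ... | false | false | true  = case trans (sym Qe) (X⊆Q e Xe) of λ ()

-- Degrees

incident-fst : ∀ G e → incident G e (proj₁ (ends G e)) ≡ true
incident-fst G e rewrite ⌊⌋-true (proj₁ (ends G e) ≟ proj₁ (ends G e)) refl = refl

incident-snd : ∀ G e → incident G e (proj₂ (ends G e)) ≡ true
incident-snd G e rewrite ⌊⌋-true (proj₂ (ends G e) ≟ proj₂ (ends G e)) refl = ∨-zeroʳ _

incident-cases : ∀ G {e v} → incident G e v ≡ true → v ≡ proj₁ (ends G e) ⊎ v ≡ proj₂ (ends G e)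
incident-cases G {e} {v} e∋v with v ≟ proj₁ (ends G e) | v ≟ proj₂ (ends G e)
... | yes v≡x | _       = inj₁ v≡x
... | no _    | yes v≡y = inj₂ v≡y

incident-false : ∀ G {e v} → v ≢ proj₁ (ends G e) → v ≢ proj₂ (ends G e) → incident G e v ≡ false
incident-false G {e} {v} v≢x v≢y = cong₂ _∨_ (⌊⌋-false (v ≟ _) v≢x) (⌊⌋-false (v ≟ _) v≢y)

joins⇒incident : ∀ G {e u v} → Joins G e u v → incident G e u ≡ true × incident G e v ≡ true
joins⇒incident G {e} (inj₁ refl) = incident-fst G e , incident-snd G e
joins⇒incident G {e} (inj₂ refl) = incident-snd G e , incident-fst G e

handshake : ∀ G (X : EdgeSet G) → ∑ (deg G X) ≡ 2 * count X
handshake G X =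
  begin
    ∑ (λ v → count (λ e → X e ∧ incident G e v))
  ≡⟨ ∑-cong {n G} (λ v → trans (count≡∑χ {m G} _) (∑-cong {m G} (λ e → χ-∧ (X e) _))) ⟩
    ∑ (λ v → ∑ (λ e → χ (X e) * χ (incident G e v)))
  ≡⟨ ∑-comm {n G} {m G} _ ⟩
    ∑ (λ e → ∑ (λ v → χ (X e) * χ (incident G e v)))
  ≡⟨ ∑-cong {m G} (λ e → *-distribˡ-∑ {n G} (χ (X e)) _) ⟩
    ∑ (λ e → χ (X e) * ∑ (χ ∘ incident G e))
  ≡⟨ ∑-cong {m G} (λ e → cong (χ (X e) *_) (trans (sym (count≡∑χ {n G} _)) (count-pair (loopless G e)))) ⟩
    ∑ (λ e → χ (X e) * 2)
  ≡⟨ trans (∑-cong {m G} (λ e → *-comm (χ (X e)) 2)) (*-distribˡ-∑ 2 (χ ∘ X)) ⟩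
    2 * ∑ (χ ∘ X)
  ≡⟨ cong (2 *_) (sym (count≡∑χ X)) ⟩
    2 * count X
  ∎
  where open ≡-Reasoning

regular-size : ∀ G {X} r → (∀ v → deg G X v ≡ r) → 2 * count X ≡ n G * r
regular-size G {X} r regular = trans (sym (handshake G X)) (trans (∑-cong regular) (∑-const (n G) r))

oneFactor-size : ∀ G {M} → OneFactor G M → 2 * size G M ≡ n G
oneFactor-size G {M} factor = trans (regular-size G 1 factor) (*-identityʳ (n G))

cubic-size : ∀ G → Cubic G → 2 * m G ≡ 3 * n G
cubic-size G cubic = begin
  2 * m G                     ≡⟨ cong (2 *_) (trans (sym (*-identityʳ (m G))) (sym (count-const (m G) true))) ⟩
  2 * count (allEdges G)      ≡⟨ regular-size G 3 cubic ⟩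
  n G * 3                     ≡⟨ *-comm (n G) 3 ⟩
  3 * n G                     ∎
  where open ≡-Reasoning

deg-mono : ∀ G {X Y : EdgeSet G} → X ⊆ Y → ∀ v → deg G X v ≤ deg G Y v
deg-mono G {X} X⊆Y v = count-mono (λ e e∈X∩v → ∧-intro (X⊆Y e (∧-elimˡ e∈X∩v)) (∧-elimʳ (X e) e∈X∩v))

deg-addIf : ∀ G {X} b e₀ → X e₀ ≡ false → ∀ v →
            deg G (addIf b e₀ X) v ≡ deg G X v + χ (b ∧ incident G e₀ v)
deg-addIf G {X} b e₀ e₀∉X v = begin
  count (λ e → (X e ∨ (b ∧ ⌊ e ≟ e₀ ⌋)) ∧ incident G e v)                 ≡⟨ count-cong (λ e → ∧-distribʳ-∨ _ (X e) _) ⟩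
  count (λ e → (X e ∧ incident G e v) ∨ ((b ∧ ⌊ e ≟ e₀ ⌋) ∧ incident G e v)) ≡⟨ count-disjoint-∨ _ _ disjoint ⟩
  deg G X v + count (λ e → (b ∧ ⌊ e ≟ e₀ ⌋) ∧ incident G e v)             ≡⟨ cong (deg G X v +_) (count-cong rearrange) ⟩
  deg G X v + count (λ e → ⌊ e ≟ e₀ ⌋ ∧ (b ∧ incident G e v))             ≡⟨ cong (deg G X v +_) (count-singleton-∧ e₀ _) ⟩
  deg G X v + χ (b ∧ incident G e₀ v)                                     ∎
  where
  open ≡-Reasoning
  rearrange : ∀ e → ((b ∧ ⌊ e ≟ e₀ ⌋) ∧ incident G e v) ≡ (⌊ e ≟ e₀ ⌋ ∧ (b ∧ incident G e v))
  rearrange e = ∧-rearrange b ⌊ e ≟ e₀ ⌋ (incident G e v)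
    where
    ∧-rearrange : ∀ x y z → ((x ∧ y) ∧ z) ≡ (y ∧ (x ∧ z))
    ∧-rearrange true  y z = refl
    ∧-rearrange false y z = sym (∧-zeroʳ y)
  disjoint : Disjoint (λ e → X e ∧ incident G e v) (λ e → (b ∧ ⌊ e ≟ e₀ ⌋) ∧ incident G e v)
  disjoint e e∈X e-new with e ≟ e₀
  ... | yes refl = case trans (sym e₀∉X) (∧-elimˡ e∈X) of λ ()
  ... | no  _    = case trans (sym (∧-zeroʳ b)) (∧-elimˡ e-new) of λ ()

oneFactor-at-most-one : ∀ G {F} → OneFactor G F → ∀ v {e e'} → e ≢ e' → F e ≡ true → F e' ≡ true →
                        incident G e v ≡ true → incident G e' v ≡ true → ⊥
oneFactor-at-most-one G {F} F-factor v e≢e' e∈F e'∈F e∋v e'∋v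
  with subst (2 ≤_) (F-factor v) (2≤count (λ x → F x ∧ incident G x v) e≢e' (∧-intro e∈F e∋v) (∧-intro e'∈F e'∋v))
... | s≤s ()

-- Even circuits

odd : ℕ → Bool
odd zero    = false
odd (suc j) = not (odd j)

odd≡false⇒2∣ : ∀ j → odd j ≡ false → 2 ∣ j
odd≡false⇒2∣ zero          _ = 2 ∣0
odd≡false⇒2∣ (suc zero)    ()
odd≡false⇒2∣ (suc (suc j)) even rewrite not-involutive (odd j) =
  ∣m∣n⇒∣m+n (∣-refl {2}) (odd≡false⇒2∣ j even)

2∣x+x : ∀ x → 2 ∣ x + x
2∣x+x x = divides x (x+x≡x*2 x)
  where
  x+x≡x*2 : ∀ x → x + x ≡ x * 2
  x+x≡x*2 = solve-∀

2∣x+[x+d]⇒2∣d : ∀ x d → 2 ∣ x + (x + d) → 2 ∣ d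
2∣x+[x+d]⇒2∣d x d 2∣x+[x+d] = ∣m+n∣m⇒∣n (subst (2 ∣_) (sym (+-assoc x x d)) 2∣x+[x+d]) (2∣x+x x)

next-mod : ∀ l j → next {l} (j mod suc l) ≡ suc j mod suc l
next-mod l j = toℕ-injective (begin
    toℕ (next (j mod L))      ≡⟨ toℕ-fromℕ< _ ⟩
    suc (toℕ (j mod L)) % L   ≡⟨ cong (λ r → suc r % L) (toℕ-fromℕ< (m%n<n j L)) ⟩
    (1 + j % L) % L           ≡⟨ %-distribˡ-+ 1 (j % L) L ⟩
    (1 % L + j % L % L) % L   ≡⟨ cong (λ r → (1 % L + r) % L) (m%n%n≡m%n j L) ⟩
    (1 % L + j % L) % L       ≡⟨ %-distribˡ-+ 1 j L ⟨
    suc j % L                 ≡⟨ toℕ-fromℕ< (m%n<n (suc j) L) ⟨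
    toℕ (suc j mod L)         ∎)
  where
  open ≡-Reasoning
  L = suc l

next-≢ : ∀ {l} → 1 ≤ l → (i : Fin (suc l)) → next i ≢ i
next-≢ {l} 1≤l i next≡i with toℕ i <? l
... | yes i<l = 1+n≢n (begin
    suc (toℕ i)              ≡⟨ m<n⇒m%n≡m (s≤s i<l) ⟨
    suc (toℕ i) % suc l      ≡⟨ toℕ-fromℕ< _ ⟨
    toℕ (next i)             ≡⟨ cong toℕ next≡i ⟩
    toℕ i                    ∎)
  where open ≡-Reasoning
... | no i≮l = <-irrefl (sym l≡0) 1≤l
  where
  i≡l : toℕ i ≡ l
  i≡l = ≤-antisym (≤-pred (toℕ<n i)) (≮⇒≥ i≮l)
  l≡0 : l ≡ 0
  l≡0 = begin
    l                    ≡⟨ i≡l ⟨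
    toℕ i                ≡⟨ cong toℕ next≡i ⟨
    toℕ (next i)         ≡⟨ toℕ-fromℕ< _ ⟩
    suc (toℕ i) % suc l  ≡⟨ cong (λ r → suc r % suc l) i≡l ⟩
    suc l % suc l        ≡⟨ n%n≡0 (suc l) ⟩
    0                    ∎
    where open ≡-Reasoning

alternating⇒even-length : ∀ {l} (f : Fin (suc l) → Bool) → (∀ i → f i ≢ f (next i)) → 2 ∣ suc l
alternating⇒even-length {l} f alternating =
  odd≡false⇒2∣ (suc l) (xor-cancel (trans (cong f wrap) (walk (suc l))))
  where
  h : ℕ → Bool
  h j = f (j mod suc l)
  step : ∀ j → h (suc j) ≡ not (h j)
  step j = ¬-not (≢-sym (subst (λ i → h j ≢ f i) (next-mod l j) (alternating (j mod suc l))))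
  walk : ∀ j → h j ≡ h 0 xor odd j
  walk zero    = sym (xor-identityʳ (h 0))
  walk (suc j) = trans (step j) (trans (cong not (walk j)) (not-distribʳ-xor (h 0) (odd j)))
  wrap : 0 mod suc l ≡ suc l mod suc l
  wrap = toℕ-injective (trans (toℕ-fromℕ< (m%n<n 0 (suc l))) (trans (sym (n%n≡0 (suc l))) (sym (toℕ-fromℕ< _))))
  xor-cancel : ∀ {a b} → a ≡ a xor b → b ≡ false
  xor-cancel {false} {b} a≡a⊕b = sym a≡a⊕b
  xor-cancel {true}  {false} _ = refl
  xor-cancel {true}  {true}  ()

EvenCircuits : (G : Graph) → EdgeSet G → Set
EvenCircuits G X = ∀ l (Z : Circuit G l) → (∀ i → X (es Z i) ≡ true) → 2 ∣ suc l

ProperColouring : (G : Graph) → EdgeSet G → (Fin (n G) → Bool) → Set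
ProperColouring G X c = ∀ e → X e ≡ true → c (proj₁ (ends G e)) ≢ c (proj₂ (ends G e))

properColouring⇒evenCircuits : ∀ G {X} c → ProperColouring G X c → EvenCircuits G X
properColouring⇒evenCircuits G c proper l Z Z⊆X =
  alternating⇒even-length (c ∘ vs Z) (λ i → colours-differ (joins Z i) (proper _ (Z⊆X i)))
  where
  colours-differ : ∀ {e u v} → Joins G e u v →
                   c (proj₁ (ends G e)) ≢ c (proj₂ (ends G e)) → c u ≢ c v
  colours-differ (inj₁ refl) c≢ = c≢
  colours-differ (inj₂ refl) c≢ = ≢-sym c≢

ProperEdgeLabelling : (G : Graph) → EdgeSet G → (Fin (m G) → Bool) → Set
ProperEdgeLabelling G X lab = ∀ v {e e'} → e ≢ e' → X e ≡ true → X e' ≡ true →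
  incident G e v ≡ true → incident G e' v ≡ true → lab e ≢ lab e'

properEdgeLabelling⇒evenCircuits : ∀ G {X} lab → ProperEdgeLabelling G X lab → EvenCircuits G X
properEdgeLabelling⇒evenCircuits G lab proper l Z Z⊆X =
  alternating⇒even-length (lab ∘ es Z) λ i →
    proper (vs Z (next i))
           (λ eᵢ≡eᵢ₊₁ → next-≢ (nontrivial Z) i (sym (es-inj Z eᵢ≡eᵢ₊₁)))
           (Z⊆X i) (Z⊆X (next i))
           (proj₂ (joins⇒incident G (joins Z i)))
           (proj₁ (joins⇒incident G (joins Z (next i))))

symmetricDifference-isEvenCycle : ∀ G {M M'} → OneFactor G M → OneFactor G M' → IsEvenCycle G (M ∆ M')
symmetricDifference-isEvenCycle G {M} {M'} M-factor M'-factor =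
  isCycle , properEdgeLabelling⇒evenCircuits G M labelled
  where
  isCycle : IsCycle G (M ∆ M')
  isCycle v = 2∣x+[x+d]⇒2∣d (deg G (M ∩ M') v) _ (subst (2 ∣_) (sym degrees) (∣-refl {2}))
    where
    degrees : deg G (M ∩ M') v + (deg G (M ∩ M') v + deg G (M ∆ M') v) ≡ 2
    degrees = trans (count⟨⟩-∆ M M' (star G v)) (cong₂ _+_ (M-factor v) (M'-factor v))
  labelled : ProperEdgeLabelling G (M ∆ M') M
  labelled v {e} {e'} e≢e' e∈ e'∈ e∋v e'∋v same-label with M e in Me | M e' in Me'
  ... | true  | true  = oneFactor-at-most-one G M-factor v e≢e' Me Me' e∋v e'∋v
  ... | false | false = oneFactor-at-most-one G M'-factor v e≢e' e∈ e'∈ e∋v e'∋v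

split-isCycle : ∀ G {T Q X : EdgeSet G} → Disjoint T Q → X ⊆ Q → IsCycle G Q →
  (∀ v → 2 ∣ deg G T v + deg G X v) → IsCycle G (T ∪ X) × IsCycle G (T ∪ (Q ∖ X))
split-isCycle G {T} {Q} {X} disjoint X⊆Q Q-cycle T+X-even = T∪X-cycle , T∪Q∖X-cycle
  where
  T∪X-cycle : IsCycle G (T ∪ X)
  T∪X-cycle v = subst (2 ∣_) (sym (count⟨⟩-∪ (λ e Te Xe → disjoint e Te (X⊆Q e Xe)) (star G v))) (T+X-even v)
  T∪Q∖X-cycle : IsCycle G (T ∪ (Q ∖ X))
  T∪Q∖X-cycle v = ∣m+n∣m⇒∣n
    (subst (2 ∣_) (sym (count⟨⟩-split disjoint X⊆Q (star G v)))
           (subst (2 ∣_) (+-assoc (deg G T v) _ _) (∣m∣n⇒∣m+n (2∣x+x (deg G T v)) (Q-cycle v))))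
    (T∪X-cycle v)

-- Matchings in bipartite graphs of maximum degree two

module SaturatingMatching
  (G : Graph) (Q : EdgeSet G) (c : Fin (n G) → Bool)
  (Q-proper : ProperColouring G Q c) (Q-deg≤2 : ∀ v → deg G Q v ≤ 2) where

  private
    V : Set
    V = Fin (n G)

    end₁ end₂ : Fin (m G) → V
    end₁ e = proj₁ (ends G e)
    end₂ e = proj₂ (ends G e)

  covered : EdgeSet G → V → Bool
  covered N v = deg G N v ≡ᵇ 1

  κ : EdgeSet G → V → Bool
  κ N v = c v xor covered N v

  -- Invariant of the edge-by-edge construction, for S ⊆ Q. The components of S (labelled by comp)
  -- are paths and even circuits. On a path with ends v and w, a matching saturating the inner
  -- vertices covers exactly one end iff c v ≡ c w, which κ-ends records; this is what allows
  -- closing a path into a circuit.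
  record Matched (S : EdgeSet G) : Set where
    field
      N             : EdgeSet G
      N⊆S           : N ⊆ S
      saturating    : ∀ v → deg G S v ≡ 2 → deg G N v ≡ 1
      comp          : V → V
      comp-edge     : ∀ e → S e ≡ true → comp (end₁ e) ≡ comp (end₂ e)
      comp-isolated : ∀ v w → deg G S v ≡ 0 → comp w ≡ comp v → w ≡ v
      κ-ends        : ∀ v w → deg G S v ≡ 1 → deg G S w ≡ 1 → v ≢ w → comp v ≡ comp w → κ N v ≢ κ N w

  empty-matched : Matched (const false)
  empty-matched = record
    { N = const false ; N⊆S = λ _ () ; saturating = λ v d≡2 → contradiction (trans (sym (deg-empty v)) d≡2) λ ()
    ; comp = id ; comp-edge = λ _ () ; comp-isolated = λ _ _ _ → id
    ; κ-ends = λ v _ d≡1 → contradiction (trans (sym (deg-empty v)) d≡1) λ () }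
    where
    deg-empty : ∀ v → deg G (const false) v ≡ 0
    deg-empty v = trans (count-const (m G) false) (*-zeroʳ (m G))

  Matched-cong : ∀ {S S'} → (∀ e → S e ≡ S' e) → Matched S → Matched S'
  Matched-cong S≗S' M = record
    { N = N ; comp = comp
    ; N⊆S           = λ e e∈N → trans (sym (S≗S' e)) (N⊆S e e∈N)
    ; saturating    = λ v d → saturating v (trans (count⟨⟩-cong S≗S' (star G v)) d)
    ; comp-edge     = λ e e∈S' → comp-edge e (trans (S≗S' e) e∈S')
    ; comp-isolated = λ v w d → comp-isolated v w (trans (count⟨⟩-cong S≗S' (star G v)) d)
    ; κ-ends        = λ v w dv dw → κ-ends v w (trans (count⟨⟩-cong S≗S' (star G v)) dv) (trans (count⟨⟩-cong S≗S' (star G w)) dw)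
    }
    where open Matched M

  deg-N≤1 : ∀ {S} → S ⊆ Q → (M : Matched S) → ∀ v → deg G (Matched.N M) v ≤ 1
  deg-N≤1 {S} S⊆Q M v with ≤2⇒≤1⊎≡2 (≤-trans (deg-mono G S⊆Q v) (Q-deg≤2 v))
  ... | inj₁ d≤1 = ≤-trans (deg-mono G (Matched.N⊆S M) v) d≤1
  ... | inj₂ d≡2 = ≤-reflexive (Matched.saturating M v d≡2)

  covered-complement : ∀ d d' → d + d' ≡ 1 → (d ≡ᵇ 1) ≡ not (d' ≡ᵇ 1)
  covered-complement 0 1 _ = refl
  covered-complement 1 0 _ = refl

  module Flip {S} (M : Matched S) (r : V) where
    open Matched M

    N⁻ : EdgeSet G
    N⁻ e = N e xor (S e ∧ ⌊ comp (end₁ e) ≟ r ⌋)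

    comp-incident : ∀ {e v} → S e ≡ true → incident G e v ≡ true → comp (end₁ e) ≡ comp v
    comp-incident {e} {v} e∈S e∋v with incident-cases G {e} {v} e∋v
    ... | inj₁ refl = refl
    ... | inj₂ refl = comp-edge e e∈S

    deg-inside : ∀ v → comp v ≡ r → deg G N⁻ v + deg G N v ≡ deg G S v
    deg-inside v cv≡r = count-+ _ _ _ λ e →
      flip-inside (N e) (S e) _ (incident G e v) (N⊆S e)
                  (λ e∋v e∈S → ⌊⌋-true (comp (end₁ e) ≟ r) (trans (comp-incident e∈S e∋v) cv≡r))
      where
      flip-inside : ∀ n s d i → (n ≡ true → s ≡ true) → (i ≡ true → s ≡ true → d ≡ true) →
                    χ ((n xor (s ∧ d)) ∧ i) + χ (n ∧ i) ≡ χ (s ∧ i)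
      flip-inside n s d false _ _ rewrite ∧-zeroʳ (n xor (s ∧ d)) | ∧-zeroʳ n | ∧-zeroʳ s = refl
      flip-inside false false d true _   _ = refl
      flip-inside true  false d true n⇒s _ = case n⇒s refl of λ ()
      flip-inside false true  d true _ d! rewrite d! refl refl = refl
      flip-inside true  true  d true _ d! rewrite d! refl refl = refl

    deg-outside : ∀ v → comp v ≢ r → deg G N⁻ v ≡ deg G N v
    deg-outside v cv≢r = count-cong λ e →
      flip-outside (N e) (S e) _ (incident G e v)
                   (λ e∋v e∈S → ⌊⌋-false (comp (end₁ e) ≟ r) (cv≢r ∘ trans (sym (comp-incident e∈S e∋v))))
      where
      flip-outside : ∀ n s d i → (i ≡ true → s ≡ true → d ≡ false) → ((n xor (s ∧ d)) ∧ i) ≡ (n ∧ i)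
      flip-outside n s     d false _  = trans (∧-zeroʳ _) (sym (∧-zeroʳ n))
      flip-outside n false d true  _  = cong (_∧ true) (xor-identityʳ n)
      flip-outside n true  d true  d! rewrite d! refl refl = cong (_∧ true) (xor-identityʳ n)

    κ-inside : ∀ v → comp v ≡ r → deg G S v ≡ 1 → κ N⁻ v ≡ not (κ N v)
    κ-inside v cv≡r dS≡1 =
      trans (cong (c v xor_) (covered-complement (deg G N⁻ v) (deg G N v) (trans (deg-inside v cv≡r) dS≡1)))
            (sym (not-distribʳ-xor (c v) (covered N v)))

    κ-outside : ∀ v → comp v ≢ r → κ N⁻ v ≡ κ N v
    κ-outside v cv≢r = cong (λ d → c v xor (d ≡ᵇ 1)) (deg-outside v cv≢r)

    flipped : Matched S
    flipped = record
      { N = N⁻ ; N⊆S = N⁻⊆S ; saturating = saturating⁻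
      ; comp = comp ; comp-edge = comp-edge ; comp-isolated = comp-isolated ; κ-ends = κ-ends⁻ }
      where
      N⁻⊆S : N⁻ ⊆ S
      N⁻⊆S e e∈N⁻ with S e in e∈S
      ... | true  = refl
      ... | false = trans (sym e∈S) (N⊆S e (trans (sym (xor-identityʳ (N e))) e∈N⁻))
      saturating⁻ : ∀ v → deg G S v ≡ 2 → deg G N⁻ v ≡ 1
      saturating⁻ v dS≡2 with comp v ≟ r
      ... | yes cv≡r = +-cancelʳ-≡ _ _ _ (trans (deg-inside v cv≡r) (trans dS≡2 (cong (1 +_) (sym (saturating v dS≡2)))))
      ... | no  cv≢r = trans (deg-outside v cv≢r) (saturating v dS≡2)
      κ-ends⁻ : ∀ v w → deg G S v ≡ 1 → deg G S w ≡ 1 → v ≢ w → comp v ≡ comp w → κ N⁻ v ≢ κ N⁻ w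
      κ-ends⁻ v w dv dw v≢w cv≡cw with comp v ≟ r
      ... | yes cv≡r = λ κ⁻≡ → κ-ends v w dv dw v≢w cv≡cw
                         (not-injective (trans (sym (κ-inside v cv≡r dv)) (trans κ⁻≡ (κ-inside w (trans (sym cv≡cw) cv≡r) dw))))
      ... | no  cv≢r = λ κ⁻≡ → κ-ends v w dv dw v≢w cv≡cw
                         (trans (sym (κ-outside v cv≢r)) (trans κ⁻≡ (κ-outside w (cv≢r ∘ trans cv≡cw))))

  module Extend {S} (S⊆Q : S ⊆ Q) (M : Matched S) (e₀ : Fin (m G))
                (e₀∉S : S e₀ ≡ false) (e₀∈Q : Q e₀ ≡ true) where
    open Matched M

    x y : V
    x = end₁ e₀
    y = end₂ e₀

    S⁺ : EdgeSet G
    S⁺ = addIf true e₀ S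

    S⁺⊆Q : S⁺ ⊆ Q
    S⁺⊆Q e e∈S⁺ with S e in e∈S
    ... | true  = S⊆Q e e∈S
    ... | false = subst (λ a → Q a ≡ true) (sym (⌊⌋-sound (e ≟ e₀) e∈S⁺)) e₀∈Q

    deg-S⁺-x : deg G S⁺ x ≡ suc (deg G S x)
    deg-S⁺-x = trans (deg-addIf G true e₀ e₀∉S x)
                     (trans (cong (λ i → deg G S x + χ i) (incident-fst G e₀)) (+-comm _ 1))

    deg-S⁺-y : deg G S⁺ y ≡ suc (deg G S y)
    deg-S⁺-y = trans (deg-addIf G true e₀ e₀∉S y)
                     (trans (cong (λ i → deg G S y + χ i) (incident-snd G e₀)) (+-comm _ 1))

    deg-S⁺-elsewhere : ∀ {v} → v ≢ x → v ≢ y → deg G S⁺ v ≡ deg G S v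
    deg-S⁺-elsewhere {v} v≢x v≢y =
      trans (deg-addIf G true e₀ e₀∉S v)
            (trans (cong (λ i → deg G S v + χ i) (incident-false G v≢x v≢y)) (+-identityʳ _))

    deg-S-x≤1 : deg G S x ≤ 1
    deg-S-x≤1 = ≤-pred (subst (_≤ 2) deg-S⁺-x (≤-trans (deg-mono G S⁺⊆Q x) (Q-deg≤2 x)))

    deg-S-y≤1 : deg G S y ≤ 1
    deg-S-y≤1 = ≤-pred (subst (_≤ 2) deg-S⁺-y (≤-trans (deg-mono G S⁺⊆Q y) (Q-deg≤2 y)))

    isolated⇒uncovered : ∀ v → deg G S v ≡ 0 → deg G N v ≡ 0
    isolated⇒uncovered v dS≡0 = n≤0⇒n≡0 (subst (deg G N v ≤_) dS≡0 (deg-mono G N⊆S v))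

    was-isolated-x : deg G S⁺ x ≡ 1 → deg G S x ≡ 0
    was-isolated-x = suc-injective ∘ trans (sym deg-S⁺-x)

    was-isolated-y : deg G S⁺ y ≡ 1 → deg G S y ≡ 0
    was-isolated-y = suc-injective ∘ trans (sym deg-S⁺-y)

    was-end : ∀ {u} → u ≢ x → u ≢ y → deg G S⁺ u ≡ 1 → deg G S u ≡ 1
    was-end u≢x u≢y = trans (sym (deg-S⁺-elsewhere u≢x u≢y))

    data Position (v : V) : Set where
      at-x      : v ≡ x → Position v
      at-y      : v ≡ y → Position v
      elsewhere : v ≢ x → v ≢ y → Position v

    position : ∀ v → Position v
    position v with v ≟ x | v ≟ y
    ... | yes v≡x | _       = at-x v≡x
    ... | no  _   | yes v≡y = at-y v≡y
    ... | no  v≢x | no  v≢y = elsewhere v≢x v≢y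

    module Balanced (balanced : deg G S x ≡ 1 → deg G S y ≡ 1 → deg G N x ≡ deg G N y) where

      both-uncovered : Bool
      both-uncovered = not (covered N x) ∧ not (covered N y)

      N⁺ : EdgeSet G
      N⁺ = addIf both-uncovered e₀ N

      comp⁺ : V → V
      comp⁺ v = if ⌊ comp v ≟ comp x ⌋ then comp y else comp v

      e₀∉N : N e₀ ≡ false
      e₀∉N = ⊆-false N⊆S e₀∉S

      deg-N⁺-x : deg G N⁺ x ≡ deg G N x + χ both-uncovered
      deg-N⁺-x = trans (deg-addIf G both-uncovered e₀ e₀∉N x)
                       (cong (λ i → deg G N x + χ i) (trans (cong (both-uncovered ∧_) (incident-fst G e₀)) (∧-identityʳ _)))

      deg-N⁺-y : deg G N⁺ y ≡ deg G N y + χ both-uncovered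
      deg-N⁺-y = trans (deg-addIf G both-uncovered e₀ e₀∉N y)
                       (cong (λ i → deg G N y + χ i) (trans (cong (both-uncovered ∧_) (incident-snd G e₀)) (∧-identityʳ _)))

      deg-N⁺-elsewhere : ∀ {v} → v ≢ x → v ≢ y → deg G N⁺ v ≡ deg G N v
      deg-N⁺-elsewhere {v} v≢x v≢y =
        trans (deg-addIf G both-uncovered e₀ e₀∉N v)
              (trans (cong (λ i → deg G N v + χ (both-uncovered ∧ i)) (incident-false G v≢x v≢y))
                     (trans (cong (λ i → deg G N v + χ i) (∧-zeroʳ _)) (+-identityʳ _)))

      κ⁺-elsewhere : ∀ {v} → v ≢ x → v ≢ y → κ N⁺ v ≡ κ N v
      κ⁺-elsewhere {v} v≢x v≢y = cong (λ d → c v xor (d ≡ᵇ 1)) (deg-N⁺-elsewhere v≢x v≢y)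

      N⁺⊆S⁺ : N⁺ ⊆ S⁺
      N⁺⊆S⁺ e e∈N⁺ with N e in e∈N
      ... | true  = ∨-introˡ _ (N⊆S e e∈N)
      ... | false = ∨-introʳ (S e) (∧-elimʳ both-uncovered e∈N⁺)

      uncovered-partner-of-x : deg G N x ≡ 0 → deg G S x ≡ 1 → deg G N y ≡ 0
      uncovered-partner-of-x dNx≡0 dSx≡1 with ≤1⇒0⊎1 deg-S-y≤1
      ... | inj₁ dSy≡0 = isolated⇒uncovered y dSy≡0
      ... | inj₂ dSy≡1 = trans (sym (balanced dSx≡1 dSy≡1)) dNx≡0

      uncovered-partner-of-y : deg G N y ≡ 0 → deg G S y ≡ 1 → deg G N x ≡ 0
      uncovered-partner-of-y dNy≡0 dSy≡1 with ≤1⇒0⊎1 deg-S-x≤1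
      ... | inj₁ dSx≡0 = isolated⇒uncovered x dSx≡0
      ... | inj₂ dSx≡1 = trans (balanced dSx≡1 dSy≡1) dNy≡0

      saturating⁺ : ∀ v → deg G S⁺ v ≡ 2 → deg G N⁺ v ≡ 1
      saturating⁺ v dS⁺≡2 with position v
      ... | at-x refl with ≤1⇒0⊎1 (deg-N≤1 S⊆Q M x)
      ...   | inj₁ dNx≡0 = trans deg-N⁺-x (cong₂ (λ d d' → d + χ (not (d ≡ᵇ 1) ∧ not (d' ≡ᵇ 1))) dNx≡0
                             (uncovered-partner-of-x dNx≡0 (suc-injective (trans (sym deg-S⁺-x) dS⁺≡2))))
      ...   | inj₂ dNx≡1 = trans deg-N⁺-x (cong (λ d → d + χ (not (d ≡ᵇ 1) ∧ not (covered N y))) dNx≡1)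
      saturating⁺ v dS⁺≡2 | at-y refl with ≤1⇒0⊎1 (deg-N≤1 S⊆Q M y)
      ...   | inj₁ dNy≡0 = trans deg-N⁺-y (cong₂ (λ d' d → d + χ (not (d' ≡ᵇ 1) ∧ not (d ≡ᵇ 1)))
                             (uncovered-partner-of-y dNy≡0 (suc-injective (trans (sym deg-S⁺-y) dS⁺≡2))) dNy≡0)
      ...   | inj₂ dNy≡1 = trans deg-N⁺-y (trans (cong (λ d → d + χ (not (covered N x) ∧ not (d ≡ᵇ 1))) dNy≡1)
                                                 (cong (λ b → 1 + χ b) (∧-zeroʳ _)))
      saturating⁺ v dS⁺≡2 | elsewhere v≢x v≢y =
        trans (deg-N⁺-elsewhere v≢x v≢y) (saturating v (trans (sym (deg-S⁺-elsewhere v≢x v≢y)) dS⁺≡2))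

      comp⁺-merged : ∀ {v} → comp v ≡ comp x → comp⁺ v ≡ comp y
      comp⁺-merged {v} cv≡cx = cong (λ t → if t then comp y else comp v) (⌊⌋-true (comp v ≟ comp x) cv≡cx)

      comp⁺-kept : ∀ {v} → comp v ≢ comp x → comp⁺ v ≡ comp v
      comp⁺-kept {v} cv≢cx = cong (λ t → if t then comp y else comp v) (⌊⌋-false (comp v ≟ comp x) cv≢cx)

      comp⁺-y : comp⁺ y ≡ comp y
      comp⁺-y with comp y ≟ comp x
      ... | yes _ = refl
      ... | no  _ = refl

      comp-edge⁺ : ∀ e → S⁺ e ≡ true → comp⁺ (end₁ e) ≡ comp⁺ (end₂ e)
      comp-edge⁺ e e∈S⁺ with S e in e∈S
      ... | true  = cong (λ a → if ⌊ a ≟ comp x ⌋ then comp y else a) (comp-edge e e∈S)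
      ... | false with ⌊⌋-sound (e ≟ e₀) e∈S⁺
      ...   | refl = trans (comp⁺-merged refl) (sym comp⁺-y)

      comp-isolated⁺ : ∀ v w → deg G S⁺ v ≡ 0 → comp⁺ w ≡ comp⁺ v → w ≡ v
      comp-isolated⁺ v w dS⁺≡0 cw⁺≡cv⁺ with position v
      ... | at-x refl = contradiction (trans (sym deg-S⁺-x) dS⁺≡0) λ ()
      ... | at-y refl = contradiction (trans (sym deg-S⁺-y) dS⁺≡0) λ ()
      ... | elsewhere v≢x v≢y = separate (comp w ≟ comp x)
        where
        dSv≡0 : deg G S v ≡ 0
        dSv≡0 = trans (sym (deg-S⁺-elsewhere v≢x v≢y)) dS⁺≡0
        cw⁺≡cv : comp⁺ w ≡ comp v
        cw⁺≡cv = trans cw⁺≡cv⁺ (comp⁺-kept (λ cv≡cx → v≢x (sym (comp-isolated v x dSv≡0 (sym cv≡cx)))))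
        separate : Dec (comp w ≡ comp x) → w ≡ v
        separate (yes cw≡cx) = contradiction (comp-isolated v y dSv≡0 (trans (sym (comp⁺-merged cw≡cx)) cw⁺≡cv)) (v≢y ∘ sym)
        separate (no  cw≢cx) = comp-isolated v w dSv≡0 (trans (sym (comp⁺-kept cw≢cx)) cw⁺≡cv)

      κ⁺-x : deg G S x ≡ 0 → κ N⁺ x ≡ κ N y
      κ⁺-x dSx≡0 = begin
        c x xor covered N⁺ x
          ≡⟨ cong (λ d → c x xor (d ≡ᵇ 1)) (trans deg-N⁺-x
               (cong (λ d → d + χ (not (d ≡ᵇ 1) ∧ not (covered N y))) (isolated⇒uncovered x dSx≡0))) ⟩
        c x xor (χ (not (covered N y)) ≡ᵇ 1)
          ≡⟨ cong (c x xor_) (χ≡ᵇ1 (not (covered N y))) ⟩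
        c x xor not (covered N y)
          ≡⟨ xor-not-swap (covered N y) (Q-proper e₀ e₀∈Q) ⟩
        c y xor covered N y
          ∎
        where open ≡-Reasoning

      κ⁺-y : deg G S y ≡ 0 → κ N⁺ y ≡ κ N x
      κ⁺-y dSy≡0 = begin
        c y xor covered N⁺ y
          ≡⟨ cong (λ d → c y xor (d ≡ᵇ 1)) (trans deg-N⁺-y (trans
               (cong (λ d → d + χ (not (covered N x) ∧ not (d ≡ᵇ 1))) (isolated⇒uncovered y dSy≡0))
               (cong χ (∧-identityʳ _)))) ⟩
        c y xor (χ (not (covered N x)) ≡ᵇ 1)
          ≡⟨ cong (c y xor_) (χ≡ᵇ1 (not (covered N x))) ⟩
        c y xor not (covered N x)
          ≡⟨ xor-not-swap (covered N x) (≢-sym (Q-proper e₀ e₀∈Q)) ⟩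
        c x xor covered N x
          ∎
        where open ≡-Reasoning

      κ⁺-x≢κ⁺-y : deg G S x ≡ 0 → deg G S y ≡ 0 → κ N⁺ x ≢ κ N⁺ y
      κ⁺-x≢κ⁺-y dSx≡0 dSy≡0 κ⁺x≡κ⁺y = Q-proper e₀ e₀∈Q (sym (xor-cancelʳ false (begin
        c y xor false  ≡⟨ cong (λ d → c y xor (d ≡ᵇ 1)) (isolated⇒uncovered y dSy≡0) ⟨
        κ N y          ≡⟨ κ⁺-x dSx≡0 ⟨
        κ N⁺ x         ≡⟨ κ⁺x≡κ⁺y ⟩
        κ N⁺ y         ≡⟨ κ⁺-y dSy≡0 ⟩
        κ N x          ≡⟨ cong (λ d → c x xor (d ≡ᵇ 1)) (isolated⇒uncovered x dSx≡0) ⟩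
        c x xor false  ∎)))
        where open ≡-Reasoning

      κ-x≢κ-y : deg G S x ≡ 1 → deg G S y ≡ 1 → κ N x ≢ κ N y
      κ-x≢κ-y dSx≡1 dSy≡1 κx≡κy =
        Q-proper e₀ e₀∈Q (xor-cancelʳ (covered N y)
          (trans (cong (c x xor_) (sym (cong (_≡ᵇ 1) (balanced dSx≡1 dSy≡1)))) κx≡κy))

      deg-S-x≡1 : ∀ {v} → comp v ≡ comp x → v ≢ x → deg G S x ≡ 1
      deg-S-x≡1 {v} cv≡cx v≢x with ≤1⇒0⊎1 deg-S-x≤1
      ... | inj₁ dSx≡0 = contradiction (comp-isolated x v dSx≡0 cv≡cx) v≢x
      ... | inj₂ dSx≡1 = dSx≡1

      deg-S-y≡1 : ∀ {w} → comp w ≡ comp y → w ≢ y → deg G S y ≡ 1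
      deg-S-y≡1 {w} cw≡cy w≢y with ≤1⇒0⊎1 deg-S-y≤1
      ... | inj₁ dSy≡0 = contradiction (comp-isolated y w dSy≡0 cw≡cy) w≢y
      ... | inj₂ dSy≡1 = dSy≡1

      -- v and w end the two paths that e₀ joins
      ends-across : ∀ {v w} → v ≢ x → w ≢ y → deg G S v ≡ 1 → deg G S w ≡ 1 →
                    comp v ≡ comp x → comp w ≡ comp y → κ N v ≢ κ N w
      ends-across v≢x w≢y dSv≡1 dSw≡1 cv≡cx cw≡cy =
        ≢-complements (κ-ends _ x dSv≡1 dSx≡1 v≢x cv≡cx) (κ-ends _ y dSw≡1 dSy≡1 w≢y cw≡cy) (κ-x≢κ-y dSx≡1 dSy≡1)
        where
        dSx≡1 = deg-S-x≡1 cv≡cx v≢x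
        dSy≡1 = deg-S-y≡1 cw≡cy w≢y

      new-end-x : ∀ {w} → w ≢ x → w ≢ y → deg G S x ≡ 0 → deg G S w ≡ 1 → comp⁺ x ≡ comp⁺ w → κ N⁺ x ≢ κ N⁺ w
      new-end-x {w} w≢x w≢y dSx≡0 dSw≡1 cx⁺≡cw⁺ κ⁺x≡κ⁺w =
        κ-ends w y dSw≡1 (deg-S-y≡1 cw≡cy w≢y) w≢y cw≡cy
          (trans (sym (κ⁺-elsewhere w≢x w≢y)) (trans (sym κ⁺x≡κ⁺w) (κ⁺-x dSx≡0)))
        where
        cw≢cx : comp w ≢ comp x
        cw≢cx cw≡cx = w≢x (comp-isolated x w dSx≡0 cw≡cx)
        cw≡cy : comp w ≡ comp y
        cw≡cy = trans (sym (comp⁺-kept cw≢cx)) (trans (sym cx⁺≡cw⁺) (comp⁺-merged refl))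

      new-end-y : ∀ {w} → w ≢ x → w ≢ y → deg G S y ≡ 0 → deg G S w ≡ 1 → comp⁺ y ≡ comp⁺ w → κ N⁺ y ≢ κ N⁺ w
      new-end-y {w} w≢x w≢y dSy≡0 dSw≡1 cy⁺≡cw⁺ κ⁺y≡κ⁺w =
        κ-ends w x dSw≡1 (deg-S-x≡1 cw≡cx w≢x) w≢x cw≡cx
          (trans (sym (κ⁺-elsewhere w≢x w≢y)) (trans (sym κ⁺y≡κ⁺w) (κ⁺-y dSy≡0)))
        where
        cw≡cx : comp w ≡ comp x
        cw≡cx = decidable-stable (comp w ≟ comp x) λ cw≢cx →
          w≢y (comp-isolated y w dSy≡0 (trans (sym (comp⁺-kept cw≢cx)) (trans (sym cy⁺≡cw⁺) comp⁺-y)))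

      old-ends : ∀ {v w} → v ≢ x → v ≢ y → w ≢ x → w ≢ y → deg G S v ≡ 1 → deg G S w ≡ 1 → v ≢ w →
                 comp⁺ v ≡ comp⁺ w → κ N v ≢ κ N w
      old-ends {v} {w} v≢x v≢y w≢x w≢y dSv≡1 dSw≡1 v≢w cv⁺≡cw⁺ = by-components (comp v ≟ comp x) (comp w ≟ comp x)
        where
        by-components : Dec (comp v ≡ comp x) → Dec (comp w ≡ comp x) → κ N v ≢ κ N w
        by-components (yes cv≡cx) (yes cw≡cx) = κ-ends v w dSv≡1 dSw≡1 v≢w (trans cv≡cx (sym cw≡cx))
        by-components (no  cv≢cx) (no  cw≢cx) =
          κ-ends v w dSv≡1 dSw≡1 v≢w (trans (sym (comp⁺-kept cv≢cx)) (trans cv⁺≡cw⁺ (comp⁺-kept cw≢cx)))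
        by-components (yes cv≡cx) (no  cw≢cx) =
          ends-across v≢x w≢y dSv≡1 dSw≡1 cv≡cx (trans (sym (comp⁺-kept cw≢cx)) (trans (sym cv⁺≡cw⁺) (comp⁺-merged cv≡cx)))
        by-components (no  cv≢cx) (yes cw≡cx) =
          ≢-sym (ends-across w≢x v≢y dSw≡1 dSv≡1 cw≡cx (trans (sym (comp⁺-kept cv≢cx)) (trans cv⁺≡cw⁺ (comp⁺-merged cw≡cx))))

      κ-ends⁺ : ∀ v w → deg G S⁺ v ≡ 1 → deg G S⁺ w ≡ 1 → v ≢ w → comp⁺ v ≡ comp⁺ w → κ N⁺ v ≢ κ N⁺ w
      κ-ends⁺ v w dv dw v≢w cv≡cw with position v | position w
      ... | at-x refl         | at-x w≡x          = contradiction (sym w≡x) v≢w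
      ... | at-x refl         | at-y refl         = κ⁺-x≢κ⁺-y (was-isolated-x dv) (was-isolated-y dw)
      ... | at-x refl         | elsewhere w≢x w≢y = new-end-x w≢x w≢y (was-isolated-x dv) (was-end w≢x w≢y dw) cv≡cw
      ... | at-y refl         | at-x refl         = ≢-sym (κ⁺-x≢κ⁺-y (was-isolated-x dw) (was-isolated-y dv))
      ... | at-y refl         | at-y w≡y          = contradiction (sym w≡y) v≢w
      ... | at-y refl         | elsewhere w≢x w≢y = new-end-y w≢x w≢y (was-isolated-y dv) (was-end w≢x w≢y dw) cv≡cw
      ... | elsewhere v≢x v≢y | at-x refl         =
        ≢-sym (new-end-x v≢x v≢y (was-isolated-x dw) (was-end v≢x v≢y dv) (sym cv≡cw))
      ... | elsewhere v≢x v≢y | at-y refl         =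
        ≢-sym (new-end-y v≢x v≢y (was-isolated-y dw) (was-end v≢x v≢y dv) (sym cv≡cw))
      ... | elsewhere v≢x v≢y | elsewhere w≢x w≢y = λ κ⁺v≡κ⁺w →
        old-ends v≢x v≢y w≢x w≢y (was-end v≢x v≢y dv) (was-end w≢x w≢y dw) v≢w cv≡cw
          (trans (sym (κ⁺-elsewhere v≢x v≢y)) (trans κ⁺v≡κ⁺w (κ⁺-elsewhere w≢x w≢y)))

      extended : Matched S⁺
      extended = record
        { N = N⁺ ; N⊆S = N⁺⊆S⁺ ; saturating = saturating⁺
        ; comp = comp⁺ ; comp-edge = comp-edge⁺ ; comp-isolated = comp-isolated⁺ ; κ-ends = κ-ends⁺ }

  same-coverage : ∀ {N u v} → deg G N u ≤ 1 → deg G N v ≤ 1 → c u ≢ c v → κ N u ≢ κ N v → deg G N u ≡ deg G N v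
  same-coverage du≤1 dv≤1 cu≢cv κu≢κv = agree (≤1⇒0⊎1 du≤1) (≤1⇒0⊎1 dv≤1) (xor-≢-agree cu≢cv κu≢κv)
    where
    agree : ∀ {a b} → a ≡ 0 ⊎ a ≡ 1 → b ≡ 0 ⊎ b ≡ 1 → (a ≡ᵇ 1) ≡ (b ≡ᵇ 1) → a ≡ b
    agree (inj₁ refl) (inj₁ refl) _ = refl
    agree (inj₂ refl) (inj₂ refl) _ = refl
    agree (inj₁ refl) (inj₂ refl) ()
    agree (inj₂ refl) (inj₁ refl) ()

  complement-in-01 : ∀ {a b f} → a ≤ 1 → b ≤ 1 → a ≢ b → f + b ≡ 1 → a ≡ f
  complement-in-01 a≤1 b≤1 = complement (≤1⇒0⊎1 a≤1) (≤1⇒0⊎1 b≤1)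
    where
    complement : ∀ {a b f} → a ≡ 0 ⊎ a ≡ 1 → b ≡ 0 ⊎ b ≡ 1 → a ≢ b → f + b ≡ 1 → a ≡ f
    complement (inj₁ refl) (inj₁ refl) a≢b _ = contradiction refl a≢b
    complement (inj₂ refl) (inj₂ refl) a≢b _ = contradiction refl a≢b
    complement (inj₁ refl) (inj₂ refl) _ f+1≡1 = sym (+-cancelʳ-≡ 1 _ 0 f+1≡1)
    complement (inj₂ refl) (inj₁ refl) _ f+0≡1 = sym (trans (sym (+-identityʳ _)) f+0≡1)

  -- Adding e₀ = xy needs x and y equally covered when both are ends of paths. Within one path this
  -- follows from κ-ends because c x ≢ c y; for two paths it is arranged by flipping the path of y.
  extend : ∀ {S} → S ⊆ Q → Matched S → ∀ e₀ → S e₀ ≡ false → Q e₀ ≡ true → Matched (addIf true e₀ S)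
  extend {S} S⊆Q M e₀ e₀∉S e₀∈Q = by-ends (≤1⇒0⊎1 deg-S-x≤1) (≤1⇒0⊎1 deg-S-y≤1)
    where
    open Matched M
    open Extend S⊆Q M e₀ e₀∉S e₀∈Q
    by-ends : deg G S x ≡ 0 ⊎ deg G S x ≡ 1 → deg G S y ≡ 0 ⊎ deg G S y ≡ 1 → Matched (addIf true e₀ S)
    by-ends (inj₁ dSx≡0) _ = Balanced.extended λ dSx≡1 _ → contradiction (trans (sym dSx≡0) dSx≡1) λ ()
    by-ends (inj₂ _) (inj₁ dSy≡0) = Balanced.extended λ _ dSy≡1 → contradiction (trans (sym dSy≡0) dSy≡1) λ ()
    by-ends (inj₂ dSx≡1) (inj₂ dSy≡1) with comp x ≟ comp y
    ... | yes cx≡cy = Balanced.extended λ _ _ →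
      same-coverage (deg-N≤1 S⊆Q M x) (deg-N≤1 S⊆Q M y) (Q-proper e₀ e₀∈Q) (κ-ends x y dSx≡1 dSy≡1 (loopless G e₀) cx≡cy)
    ... | no cx≢cy with deg G N x ≟ℕ deg G N y
    ...   | yes dNx≡dNy = Balanced.extended λ _ _ → dNx≡dNy
    ...   | no  dNx≢dNy = Extend.Balanced.extended S⊆Q (Flip.flipped M (comp y)) e₀ e₀∉S e₀∈Q λ _ _ →
      trans (Flip.deg-outside M (comp y) x cx≢cy)
            (complement-in-01 (deg-N≤1 S⊆Q M x) (deg-N≤1 S⊆Q M y) dNx≢dNy
                              (trans (Flip.deg-inside M (comp y) y refl) dSy≡1))

  add-or-skip : ∀ {S} → S ⊆ Q → Matched S → ∀ e₀ → S e₀ ≡ false → Matched (addIf (Q e₀) e₀ S)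
  add-or-skip S⊆Q M e₀ e₀∉S with Q e₀ in e₀∈Q
  ... | true  = extend S⊆Q M e₀ e₀∉S e₀∈Q
  ... | false = Matched-cong (λ e → sym (∨-identityʳ _)) M

  prefix : ℕ → EdgeSet G
  prefix j e = Q e ∧ ⌊ toℕ e <? j ⌋

  prefix-suc : ∀ {j} (j<m : j < m G) e → addIf (Q (fromℕ< j<m)) (fromℕ< j<m) (prefix j) e ≡ prefix (suc j) e
  prefix-suc {j} j<m e with e ≟ fromℕ< j<m
  ... | yes refl rewrite toℕ-fromℕ< j<m | ⌊⌋-false (j <? j) (<-irrefl refl) | ⌊⌋-true (j <? suc j) ≤-refl
    = only-eⱼ (Q e)
    where
    only-eⱼ : ∀ q → ((q ∧ false) ∨ (q ∧ true)) ≡ (q ∧ true)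
    only-eⱼ true  = refl
    only-eⱼ false = refl
  ... | no  e≢eⱼ = trans (cong ((Q e ∧ ⌊ toℕ e <? j ⌋) ∨_) (∧-zeroʳ _))
                         (trans (∨-identityʳ _) (cong (Q e ∧_) (<?-suc (e≢eⱼ ∘ toℕ-injective ∘ (λ p → trans p (sym (toℕ-fromℕ< j<m)))))))
    where
    <?-suc : ∀ {i} → i ≢ j → ⌊ i <? j ⌋ ≡ ⌊ i <? suc j ⌋
    <?-suc {i} i≢j with i <? j | i <? suc j
    ... | yes _   | yes _   = refl
    ... | no  _   | no  _   = refl
    ... | yes i<j | no  i≮j = contradiction (m<n⇒m<1+n i<j) i≮j
    ... | no  i≮j | yes i<j with m<1+n⇒m<n∨m≡n i<j
    ...   | inj₁ i<j' = contradiction i<j' i≮j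
    ...   | inj₂ i≡j  = contradiction i≡j i≢j

  matched-prefix : ∀ j → j ≤ m G → Matched (prefix j)
  matched-prefix zero    _   = Matched-cong (λ e → sym (∧-zeroʳ (Q e))) empty-matched
  matched-prefix (suc j) j<m =
    Matched-cong (prefix-suc j<m) (add-or-skip (λ e → ∧-elimˡ) (matched-prefix j (<⇒≤ j<m)) (fromℕ< j<m) eⱼ∉prefix)
    where
    eⱼ∉prefix : prefix j (fromℕ< j<m) ≡ false
    eⱼ∉prefix rewrite toℕ-fromℕ< j<m | ⌊⌋-false (j <? j) (<-irrefl refl) = ∧-zeroʳ _

  -- Clients only need the specification; unfolding the construction makes their type checking blow up.
  abstract
    saturating-matching : Σ (EdgeSet G) λ N → N ⊆ Q × (∀ v → deg G Q v ≡ 2 → deg G N v ≡ 1)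
    saturating-matching = N , N⊆S , saturating
      where
      whole : ∀ e → prefix (m G) e ≡ Q e
      whole e = trans (cong (Q e ∧_) (⌊⌋-true (toℕ e <? m G) (toℕ<n e))) (∧-identityʳ (Q e))
      open Matched (Matched-cong whole (matched-prefix (m G) ≤-refl))

-- Edge classes and the covers

exactlyOne : Bool → Bool → Bool → Bool
exactlyOne true  false false = true
exactlyOne false true  false = true
exactlyOne false false true  = true
exactlyOne _     _     _     = false

exactlyTwo : Bool → Bool → Bool → Bool
exactlyTwo true  true  false = true
exactlyTwo true  false true  = true
exactlyTwo false true  true  = true
exactlyTwo _     _     _     = false

-- In the notation of the paper, 𝓜 = B ∪ T and 𝓤 = U.
module EdgeClasses (G : Graph) (M₁ M₂ M₃ : EdgeSet G) where

  A B T U Q Core : EdgeSet G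
  A e  = exactlyOne (M₁ e) (M₂ e) (M₃ e)
  B e  = exactlyTwo (M₁ e) (M₂ e) (M₃ e)
  T e  = M₁ e ∧ M₂ e ∧ M₃ e
  U    = coreU G M₁ M₂ M₃
  Q    = B ∪ U
  Core = coreEdges G M₁ M₂ M₃

  factors-by-class : ∀ ι → count⟨ ι ⟩ M₁ + count⟨ ι ⟩ M₂ + count⟨ ι ⟩ M₃ ≡
                           count⟨ ι ⟩ A + 2 * count⟨ ι ⟩ B + 3 * count⟨ ι ⟩ T
  factors-by-class ι = begin
    count⟨ ι ⟩ M₁ + count⟨ ι ⟩ M₂ + count⟨ ι ⟩ M₃
      ≡⟨ spread (count⟨ ι ⟩ M₁) (count⟨ ι ⟩ M₂) (count⟨ ι ⟩ M₃) ⟩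
    sum (map count⟨ ι ⟩ (M₁ ∷ M₂ ∷ M₃ ∷ []))
      ≡⟨ same-multiplicity⇒same-count (_ ∷ _ ∷ _ ∷ []) (A ∷ B ∷ B ∷ T ∷ T ∷ T ∷ []) multiplicities ι ⟩
    sum (map count⟨ ι ⟩ (A ∷ B ∷ B ∷ T ∷ T ∷ T ∷ []))
      ≡⟨ collect (count⟨ ι ⟩ A) (count⟨ ι ⟩ B) (count⟨ ι ⟩ T) ⟩
    count⟨ ι ⟩ A + 2 * count⟨ ι ⟩ B + 3 * count⟨ ι ⟩ T
      ∎
    where
    open ≡-Reasoning
    spread : ∀ x y z → x + y + z ≡ x + (y + (z + 0))
    spread = solve-∀
    collect : ∀ a b t → a + (b + (b + (t + (t + (t + 0))))) ≡ a + 2 * b + 3 * t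
    collect = solve-∀
    multiplicities : ∀ e → multiplicity (M₁ ∷ M₂ ∷ M₃ ∷ []) e ≡ multiplicity (A ∷ B ∷ B ∷ T ∷ T ∷ T ∷ []) e
    multiplicities e with M₁ e | M₂ e | M₃ e
    ... | false | false | false = refl
    ... | false | false | true  = refl
    ... | false | true  | false = refl
    ... | false | true  | true  = refl
    ... | true  | false | false = refl
    ... | true  | false | true  = refl
    ... | true  | true  | false = refl
    ... | true  | true  | true  = refl

  edges-by-class : ∀ ι → count⟨ ι ⟩ (allEdges G) ≡ count⟨ ι ⟩ A + count⟨ ι ⟩ B + count⟨ ι ⟩ T + count⟨ ι ⟩ U
  edges-by-class ι = begin
    count⟨ ι ⟩ (allEdges G)
      ≡⟨ +-identityʳ _ ⟨
    sum (map count⟨ ι ⟩ (allEdges G ∷ []))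
      ≡⟨ same-multiplicity⇒same-count (_ ∷ []) (A ∷ B ∷ T ∷ U ∷ []) multiplicities ι ⟩
    sum (map count⟨ ι ⟩ (A ∷ B ∷ T ∷ U ∷ []))
      ≡⟨ collect (count⟨ ι ⟩ A) (count⟨ ι ⟩ B) (count⟨ ι ⟩ T) (count⟨ ι ⟩ U) ⟩
    count⟨ ι ⟩ A + count⟨ ι ⟩ B + count⟨ ι ⟩ T + count⟨ ι ⟩ U
      ∎
    where
    open ≡-Reasoning
    collect : ∀ a b t u → a + (b + (t + (u + 0))) ≡ a + b + t + u
    collect = solve-∀
    multiplicities : ∀ e → multiplicity (allEdges G ∷ []) e ≡ multiplicity (A ∷ B ∷ T ∷ U ∷ []) e
    multiplicities e with M₁ e | M₂ e | M₃ e
    ... | false | false | false = refl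
    ... | false | false | true  = refl
    ... | false | true  | false = refl
    ... | false | true  | true  = refl
    ... | true  | false | false = refl
    ... | true  | false | true  = refl
    ... | true  | true  | false = refl
    ... | true  | true  | true  = refl

  -- Used for the whole edge set (s = n/2) and for the star of a vertex (s = 1).
  uncovered-balance : ∀ ι s → count⟨ ι ⟩ M₁ ≡ s → count⟨ ι ⟩ M₂ ≡ s → count⟨ ι ⟩ M₃ ≡ s →
                      count⟨ ι ⟩ (allEdges G) ≡ 3 * s → count⟨ ι ⟩ U ≡ count⟨ ι ⟩ B + 2 * count⟨ ι ⟩ T
  uncovered-balance ι s M₁≡s M₂≡s M₃≡s E≡3s = +-cancelˡ-≡ (a + b + t) u (b + 2 * t) (begin
    a + b + t + u                 ≡⟨ edges-by-class ι ⟨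
    count⟨ ι ⟩ (allEdges G)       ≡⟨ E≡3s ⟩
    3 * s                         ≡⟨ three-times s ⟩
    s + s + s                     ≡⟨ cong₂ _+_ (cong₂ _+_ M₁≡s M₂≡s) M₃≡s ⟨
    count⟨ ι ⟩ M₁ + count⟨ ι ⟩ M₂ + count⟨ ι ⟩ M₃ ≡⟨ factors-by-class ι ⟩
    a + 2 * b + 3 * t             ≡⟨ regroup a b t ⟩
    a + b + t + (b + 2 * t)       ∎)
    where
    open ≡-Reasoning
    a = count⟨ ι ⟩ A
    b = count⟨ ι ⟩ B
    t = count⟨ ι ⟩ T
    u = count⟨ ι ⟩ U
    three-times : ∀ s → 3 * s ≡ s + s + s
    three-times = solve-∀
    regroup : ∀ a b t → a + 2 * b + 3 * t ≡ a + b + t + (b + 2 * t)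
    regroup = solve-∀

  differences-by-class : ∀ ι → count⟨ ι ⟩ (M₁ ∆ M₂) + count⟨ ι ⟩ (M₁ ∆ M₃) + count⟨ ι ⟩ (M₂ ∆ M₃) ≡
                               2 * count⟨ ι ⟩ A + 2 * count⟨ ι ⟩ B
  differences-by-class ι = begin
    count⟨ ι ⟩ (M₁ ∆ M₂) + count⟨ ι ⟩ (M₁ ∆ M₃) + count⟨ ι ⟩ (M₂ ∆ M₃)
      ≡⟨ spread (count⟨ ι ⟩ (M₁ ∆ M₂)) (count⟨ ι ⟩ (M₁ ∆ M₃)) (count⟨ ι ⟩ (M₂ ∆ M₃)) ⟩
    sum (map count⟨ ι ⟩ ((M₁ ∆ M₂) ∷ (M₁ ∆ M₃) ∷ (M₂ ∆ M₃) ∷ []))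
      ≡⟨ same-multiplicity⇒same-count (_ ∷ _ ∷ _ ∷ []) (A ∷ A ∷ B ∷ B ∷ []) multiplicities ι ⟩
    sum (map count⟨ ι ⟩ (A ∷ A ∷ B ∷ B ∷ []))
      ≡⟨ collect (count⟨ ι ⟩ A) (count⟨ ι ⟩ B) ⟩
    2 * count⟨ ι ⟩ A + 2 * count⟨ ι ⟩ B
      ∎
    where
    open ≡-Reasoning
    spread : ∀ x y z → x + y + z ≡ x + (y + (z + 0))
    spread = solve-∀
    collect : ∀ a b → a + (a + (b + (b + 0))) ≡ 2 * a + 2 * b
    collect = solve-∀
    multiplicities : ∀ e → multiplicity ((M₁ ∆ M₂) ∷ (M₁ ∆ M₃) ∷ (M₂ ∆ M₃) ∷ []) e ≡ multiplicity (A ∷ A ∷ B ∷ B ∷ []) e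
    multiplicities e with M₁ e | M₂ e | M₃ e
    ... | false | false | false = refl
    ... | false | false | true  = refl
    ... | false | true  | false = refl
    ... | false | true  | true  = refl
    ... | true  | false | false = refl
    ... | true  | false | true  = refl
    ... | true  | true  | false = refl
    ... | true  | true  | true  = refl

  Core≗T∪Q : ∀ e → Core e ≡ (T ∪ Q) e
  Core≗T∪Q e with M₁ e | M₂ e | M₃ e
  ... | false | false | false = refl
  ... | false | false | true  = refl
  ... | false | true  | false = refl
  ... | false | true  | true  = refl
  ... | true  | false | false = refl
  ... | true  | false | true  = refl
  ... | true  | true  | false = refl
  ... | true  | true  | true  = refl

  T-Q-disjoint : Disjoint T Q
  T-Q-disjoint e T-e Q-e with M₁ e | M₂ e | M₃ e
  T-Q-disjoint e () Q-e | false | _     | _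
  T-Q-disjoint e () Q-e | true  | false | _
  T-Q-disjoint e () Q-e | true  | true  | false
  T-Q-disjoint e T-e () | true  | true  | true

  B-U-disjoint : Disjoint B U
  B-U-disjoint e B-e U-e with M₁ e | M₂ e | M₃ e
  B-U-disjoint e () U-e | false | false | _
  B-U-disjoint e () U-e | false | true  | false
  B-U-disjoint e B-e () | false | true  | true
  B-U-disjoint e () U-e | true  | false | false
  B-U-disjoint e B-e () | true  | false | true
  B-U-disjoint e B-e () | true  | true  | _

two-of-three : ∀ x y z → 3 * (x + y) ≤ 2 * (x + y + z) ⊎ 3 * (x + z) ≤ 2 * (x + y + z) ⊎ 3 * (y + z) ≤ 2 * (x + y + z)
two-of-three x y z = drop-largest (x ≤? z) (y ≤? z) (y ≤? x)
  where
  omit : ∀ p q r → p + q ≤ r + r → 3 * (p + q) ≤ 2 * (p + q + r)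
  omit p q r p+q≤2r = begin
    3 * (p + q)             ≡⟨ split p q ⟩
    2 * (p + q) + (p + q)   ≤⟨ +-monoʳ-≤ (2 * (p + q)) p+q≤2r ⟩
    2 * (p + q) + (r + r)   ≡⟨ join p q r ⟩
    2 * (p + q + r)         ∎
    where
    open ≤-Reasoning
    split : ∀ p q → 3 * (p + q) ≡ 2 * (p + q) + (p + q)
    split = solve-∀
    join : ∀ p q r → 2 * (p + q) + (r + r) ≡ 2 * (p + q + r)
    join = solve-∀
  largest-z : x ≤ z → y ≤ z → 3 * (x + y) ≤ 2 * (x + y + z)
  largest-z x≤z y≤z = omit x y z (+-mono-≤ x≤z y≤z)
  largest-y : x ≤ y → z ≤ y → 3 * (x + z) ≤ 2 * (x + y + z)
  largest-y x≤y z≤y = subst (λ s → 3 * (x + z) ≤ 2 * s) (swap x z y) (omit x z y (+-mono-≤ x≤y z≤y))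
    where
    swap : ∀ x z y → x + z + y ≡ x + y + z
    swap = solve-∀
  largest-x : y ≤ x → z ≤ x → 3 * (y + z) ≤ 2 * (x + y + z)
  largest-x y≤x z≤x = subst (λ s → 3 * (y + z) ≤ 2 * s) (rotate y z x) (omit y z x (+-mono-≤ y≤x z≤x))
    where
    rotate : ∀ y z x → y + z + x ≡ x + y + z
    rotate = solve-∀
  drop-largest : Dec (x ≤ z) → Dec (y ≤ z) → Dec (y ≤ x) →
                 3 * (x + y) ≤ 2 * (x + y + z) ⊎ 3 * (x + z) ≤ 2 * (x + y + z) ⊎ 3 * (y + z) ≤ 2 * (x + y + z)
  drop-largest (yes x≤z) (yes y≤z) _         = inj₁ (largest-z x≤z y≤z)
  drop-largest (yes x≤z) (no  y≰z) _         = inj₂ (inj₁ (largest-y (≤-trans x≤z (≰⇒≥ y≰z)) (≰⇒≥ y≰z)))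
  drop-largest (no  x≰z) _         (yes y≤x) = inj₂ (inj₂ (largest-x y≤x (≰⇒≥ x≰z)))
  drop-largest (no  x≰z) _         (no  y≰x) = inj₂ (inj₁ (largest-y (≰⇒≥ y≰x) (≤-trans (≰⇒≥ x≰z) (≰⇒≥ y≰x))))

saturated-parity : ∀ {d q s} → d ≤ q → q ≡ 2 * s → s ≤ 1 → (q ≡ 2 → d ≡ 1) → 2 ∣ d + s
saturated-parity {d} d≤q q≡2s s≤1 saturated with ≤1⇒0⊎1 s≤1
... | inj₁ refl = subst (λ d → 2 ∣ d + 0) (sym (n≤0⇒n≡0 (subst (d ≤_) q≡2s d≤q))) (2 ∣0)
... | inj₂ refl = subst (λ d → 2 ∣ d + 1) (sym (saturated q≡2s)) ∣-refl

cover-bound : ∀ {a b t u d y e} → e ≡ a + b + t + u → u ≡ b + 2 * t →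
              3 * d ≤ 2 * (2 * a + 2 * b) → y ≤ t + (t + (b + u)) → 3 * (d + y) ≤ 4 * e + 2 * u
cover-bound {a} {b} {t} {d = d} {y} refl refl 3d≤ y≤ = begin
  3 * (d + y)                                                      ≡⟨ *-distribˡ-+ 3 d y ⟩
  3 * d + 3 * y                                                    ≤⟨ +-mono-≤ 3d≤ (*-monoʳ-≤ 3 y≤) ⟩
  2 * (2 * a + 2 * b) + 3 * (t + (t + (b + (b + 2 * t))))          ≤⟨ m≤m+n _ (4 * t) ⟩
  2 * (2 * a + 2 * b) + 3 * (t + (t + (b + (b + 2 * t)))) + 4 * t  ≡⟨ collect a b t ⟩
  4 * (a + b + t + (b + 2 * t)) + 2 * (b + 2 * t)                  ∎
  where
  open ≤-Reasoning
  collect : ∀ a b t → 2 * (2 * a + 2 * b) + 3 * (t + (t + (b + (b + 2 * t)))) + 4 * t ≡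
                      4 * (a + b + t + (b + 2 * t)) + 2 * (b + 2 * t)
  collect = solve-∀

evenCover : ∀ {G l k} (Cs : List (EdgeSet G)) → All (IsEvenCycle G) Cs → (∀ e → any (λ C → C e) Cs ≡ true) →
            length Cs ≤ l → 3 * coverLength G Cs ≤ 4 * m G + 2 * k → HasShortEvenCover G l k
evenCover Cs even covering length≤l short =
  Cs , (length≤l , (λ _ → All.lookup even) , λ e → Any.map (Equivalence.to T-≡) (any⁻ _ Cs (Equivalence.from T-≡ (covering e)))) , short

module CoreCover (G : Graph) (cubic : Cubic G) (M₁ M₂ M₃ : EdgeSet G)
  (M₁-factor : OneFactor G M₁) (M₂-factor : OneFactor G M₂) (M₃-factor : OneFactor G M₃)
  (c : Fin (n G) → Bool) (Core-proper : ProperColouring G (coreEdges G M₁ M₂ M₃) c) where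

  open EdgeClasses G M₁ M₂ M₃

  ‖_‖ : EdgeSet G → ℕ
  ‖ X ‖ = count⟨ const true ⟩ X

  size-factor : ∀ {M} → OneFactor G M → ‖ M ‖ ≡ ‖ M₁ ‖
  size-factor {M} factor = begin
    ‖ M ‖       ≡⟨ count⟨true⟩ M ⟩
    size G M    ≡⟨ *-cancelˡ-≡ _ _ 2 (trans (oneFactor-size G factor) (sym (oneFactor-size G M₁-factor))) ⟩
    size G M₁   ≡⟨ count⟨true⟩ M₁ ⟨
    ‖ M₁ ‖      ∎
    where open ≡-Reasoning

  m≡‖E‖ : m G ≡ ‖ allEdges G ‖
  m≡‖E‖ = sym (trans (count-const (m G) true) (*-identityʳ (m G)))

  m≡3‖M₁‖ : m G ≡ 3 * ‖ M₁ ‖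
  m≡3‖M₁‖ = *-cancelˡ-≡ _ _ 2 (begin
    2 * m G                ≡⟨ cubic-size G cubic ⟩
    3 * n G                ≡⟨ cong (3 *_) (oneFactor-size G M₁-factor) ⟨
    3 * (2 * size G M₁)    ≡⟨ *-comm-middle (size G M₁) ⟩
    2 * (3 * size G M₁)    ≡⟨ cong (λ s → 2 * (3 * s)) (count⟨true⟩ M₁) ⟨
    2 * (3 * ‖ M₁ ‖)       ∎)
    where
    open ≡-Reasoning
    *-comm-middle : ∀ s → 3 * (2 * s) ≡ 2 * (3 * s)
    *-comm-middle = solve-∀

  ‖U‖≡‖B‖+2‖T‖ : ‖ U ‖ ≡ ‖ B ‖ + 2 * ‖ T ‖
  ‖U‖≡‖B‖+2‖T‖ = uncovered-balance (const true) ‖ M₁ ‖ refl (size-factor M₂-factor) (size-factor M₃-factor)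
                                     (trans (sym m≡‖E‖) m≡3‖M₁‖)

  deg-B+T≤1 : ∀ v → deg G B v + deg G T v ≤ 1
  deg-B+T≤1 v = half (begin
    2 * (deg G B v + deg G T v)                          ≤⟨ m≤n+m _ (deg G A v + deg G T v) ⟩
    deg G A v + deg G T v + 2 * (deg G B v + deg G T v)  ≡⟨ regroup (deg G A v) (deg G B v) (deg G T v) ⟩
    deg G A v + 2 * deg G B v + 3 * deg G T v            ≡⟨ factors-by-class (star G v) ⟨
    deg G M₁ v + deg G M₂ v + deg G M₃ v                 ≡⟨ cong₂ _+_ (cong₂ _+_ (M₁-factor v) (M₂-factor v)) (M₃-factor v) ⟩
    3                                                    ∎)
    where
    open ≤-Reasoning
    regroup : ∀ a b t → a + t + 2 * (b + t) ≡ a + 2 * b + 3 * t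
    regroup = solve-∀
    half : ∀ {s} → 2 * s ≤ 3 → s ≤ 1
    half {0}           _ = z≤n
    half {1}           _ = s≤s z≤n
    half {suc (suc s)} 2s≤3 = contradiction (≤-trans (*-monoʳ-≤ 2 (s≤s (s≤s (z≤n {s})))) 2s≤3) λ { (s≤s (s≤s (s≤s ()))) }

  deg-Q : ∀ v → deg G Q v ≡ 2 * (deg G B v + deg G T v)
  deg-Q v = begin
    deg G Q v                           ≡⟨ count⟨⟩-∪ B-U-disjoint (star G v) ⟩
    deg G B v + deg G U v               ≡⟨ cong (deg G B v +_) (uncovered-balance (star G v) 1 (M₁-factor v) (M₂-factor v) (M₃-factor v) (cubic v)) ⟩
    deg G B v + (deg G B v + 2 * deg G T v) ≡⟨ regroup (deg G B v) (deg G T v) ⟩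
    2 * (deg G B v + deg G T v)         ∎
    where
    open ≡-Reasoning
    regroup : ∀ b t → b + (b + 2 * t) ≡ 2 * (b + t)
    regroup = solve-∀

  T⊆Core : T ⊆ Core
  T⊆Core e T-e = trans (Core≗T∪Q e) (∨-introˡ (Q e) T-e)

  Q⊆Core : Q ⊆ Core
  Q⊆Core e Q-e = trans (Core≗T∪Q e) (∨-introʳ (T e) Q-e)

  Q-proper : ProperColouring G Q c
  Q-proper e Q-e = Core-proper e (Q⊆Core e Q-e)

  Q-deg≤2 : ∀ v → deg G Q v ≤ 2
  Q-deg≤2 v = subst (_≤ 2) (sym (deg-Q v)) (*-monoʳ-≤ 2 (deg-B+T≤1 v))

  Q-isCycle : IsCycle G Q
  Q-isCycle v = divides (deg G B v + deg G T v) (trans (deg-Q v) (*-comm 2 (deg G B v + deg G T v)))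

  open SaturatingMatching G Q c Q-proper Q-deg≤2 using (saturating-matching)

  N : EdgeSet G
  N = proj₁ saturating-matching

  N⊆Q : N ⊆ Q
  N⊆Q = proj₁ (proj₂ saturating-matching)

  N-saturating : ∀ v → deg G Q v ≡ 2 → deg G N v ≡ 1
  N-saturating = proj₂ (proj₂ saturating-matching)

  X : EdgeSet G
  X = N ∆ B

  X⊆Q : X ⊆ Q
  X⊆Q = ∆-⊆ N⊆Q (λ e → ∨-introˡ (U e))

  deg-N+B+T-even : ∀ v → 2 ∣ deg G N v + (deg G B v + deg G T v)
  deg-N+B+T-even v = saturated-parity (deg-mono G N⊆Q v) (deg-Q v) (deg-B+T≤1 v) (N-saturating v)

  deg-T+X-even : ∀ v → 2 ∣ deg G T v + deg G X v
  deg-T+X-even v = 2∣x+[x+d]⇒2∣d both (deg G T v + deg G X v) (subst (2 ∣_) (sym degrees) (deg-N+B+T-even v))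
    where
    both = deg G (N ∩ B) v
    degrees : both + (both + (deg G T v + deg G X v)) ≡ deg G N v + (deg G B v + deg G T v)
    degrees = begin
      both + (both + (deg G T v + deg G X v)) ≡⟨ shift both (deg G T v) (deg G X v) ⟩
      deg G T v + (both + (both + deg G X v)) ≡⟨ cong (deg G T v +_) (count⟨⟩-∆ N B (star G v)) ⟩
      deg G T v + (deg G N v + deg G B v)     ≡⟨ rotate (deg G T v) (deg G N v) (deg G B v) ⟩
      deg G N v + (deg G B v + deg G T v)     ∎
      where
      open ≡-Reasoning
      shift : ∀ i t x → i + (i + (t + x)) ≡ t + (i + (i + x))
      shift = solve-∀
      rotate : ∀ t n b → t + (n + b) ≡ n + (b + t)
      rotate = solve-∀

  Y₁ Y₂ : EdgeSet G
  Y₁ = T ∪ X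
  Y₂ = T ∪ (Q ∖ X)

  Y₁⊆Core : Y₁ ⊆ Core
  Y₁⊆Core = ∪-⊆ T⊆Core (λ e → Q⊆Core e ∘ X⊆Q e)

  Y₂⊆Core : Y₂ ⊆ Core
  Y₂⊆Core = ∪-⊆ T⊆Core (λ e → Q⊆Core e ∘ ∧-elimˡ)

  Core-cycle⇒even : ∀ {Y} → Y ⊆ Core → IsCycle G Y → IsEvenCycle G Y
  Core-cycle⇒even Y⊆Core Y-cycle = Y-cycle , properColouring⇒evenCircuits G c (λ e Y-e → Core-proper e (Y⊆Core e Y-e))

  Y₁-even : IsEvenCycle G Y₁
  Y₁-even = Core-cycle⇒even Y₁⊆Core (proj₁ (split-isCycle G T-Q-disjoint X⊆Q Q-isCycle deg-T+X-even))

  Y₂-even : IsEvenCycle G Y₂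
  Y₂-even = Core-cycle⇒even Y₂⊆Core (proj₂ (split-isCycle G T-Q-disjoint X⊆Q Q-isCycle deg-T+X-even))

  Core⊆Y₁∪Y₂ : ∀ e → Core e ≡ true → (Y₁ e ∨ (Y₂ e ∨ false)) ≡ true
  Core⊆Y₁∪Y₂ e Core-e = split-covers (T e) (Q e) (X e) (trans (sym (Core≗T∪Q e)) Core-e)
    where
    split-covers : ∀ t q x → (t ∨ q) ≡ true → ((t ∨ x) ∨ ((t ∨ (q ∧ not x)) ∨ false)) ≡ true
    split-covers true  _     _     _  = refl
    split-covers false _     true  _  = refl
    split-covers false true  false _  = refl
    split-covers false false false ()

  ‖Y₁‖+‖Y₂‖ : ‖ Y₁ ‖ + ‖ Y₂ ‖ ≡ ‖ T ‖ + (‖ T ‖ + (‖ B ‖ + ‖ U ‖))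
  ‖Y₁‖+‖Y₂‖ = trans (count⟨⟩-split T-Q-disjoint X⊆Q (const true))
                     (cong (λ q → ‖ T ‖ + (‖ T ‖ + q)) (count⟨⟩-∪ B-U-disjoint (const true)))

  ‖Core‖ : ‖ Core ‖ ≡ ‖ T ‖ + (‖ B ‖ + ‖ U ‖)
  ‖Core‖ = trans (count⟨⟩-cong Core≗T∪Q (const true))
                 (trans (count⟨⟩-∪ T-Q-disjoint (const true)) (cong (‖ T ‖ +_) (count⟨⟩-∪ B-U-disjoint (const true))))

  CoversWithCore : EdgeSet G → EdgeSet G → Set
  CoversWithCore D D' = ∀ e → any (λ C → C e) (D ∷ D' ∷ Core ∷ []) ≡ true

  cover₁₂₋₁₃ : CoversWithCore (M₁ ∆ M₂) (M₁ ∆ M₃)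
  cover₁₂₋₁₃ e with M₁ e | M₂ e | M₃ e
  ... | false | false | false = refl
  ... | false | false | true  = refl
  ... | false | true  | false = refl
  ... | false | true  | true  = refl
  ... | true  | false | false = refl
  ... | true  | false | true  = refl
  ... | true  | true  | false = refl
  ... | true  | true  | true  = refl

  cover₁₂₋₂₃ : CoversWithCore (M₁ ∆ M₂) (M₂ ∆ M₃)
  cover₁₂₋₂₃ e with M₁ e | M₂ e | M₃ e
  ... | false | false | false = refl
  ... | false | false | true  = refl
  ... | false | true  | false = refl
  ... | false | true  | true  = refl
  ... | true  | false | false = refl
  ... | true  | false | true  = refl
  ... | true  | true  | false = refl
  ... | true  | true  | true  = refl

  cover₁₃₋₂₃ : CoversWithCore (M₁ ∆ M₃) (M₂ ∆ M₃)
  cover₁₃₋₂₃ e with M₁ e | M₂ e | M₃ e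
  ... | false | false | false = refl
  ... | false | false | true  = refl
  ... | false | true  | false = refl
  ... | false | true  | true  = refl
  ... | true  | false | false = refl
  ... | true  | false | true  = refl
  ... | true  | true  | false = refl
  ... | true  | true  | true  = refl

  ∆-even : ∀ {M M'} → OneFactor G M → OneFactor G M' → IsEvenCycle G (M ∆ M')
  ∆-even = symmetricDifference-isEvenCycle G

  by-class : ∀ {p} → p ≤ 2 * (‖ M₁ ∆ M₂ ‖ + ‖ M₁ ∆ M₃ ‖ + ‖ M₂ ∆ M₃ ‖) → p ≤ 2 * (2 * ‖ A ‖ + 2 * ‖ B ‖)
  by-class {p} = subst (p ≤_) (cong (2 *_) (differences-by-class (const true)))

  module _ (k : ℕ) (size-U≡k : size G U ≡ k) where

    short-cover : ∀ {d y} Cs → sum (map ‖_‖ Cs) ≡ d + y → 3 * d ≤ 2 * (2 * ‖ A ‖ + 2 * ‖ B ‖) →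
                  y ≤ ‖ T ‖ + (‖ T ‖ + (‖ B ‖ + ‖ U ‖)) → 3 * coverLength G Cs ≤ 4 * m G + 2 * k
    short-cover {d} {y} Cs ‖Cs‖≡d+y 3d≤ y≤ =
      subst₂ (λ L u → 3 * L ≤ 4 * m G + 2 * u) (sym (trans (coverLength≡ Cs) ‖Cs‖≡d+y)) (trans (count⟨true⟩ U) size-U≡k)
             (cover-bound {‖ A ‖} {‖ B ‖} {‖ T ‖} {‖ U ‖} {d} {y} (trans m≡‖E‖ (edges-by-class (const true))) ‖U‖≡‖B‖+2‖T‖ 3d≤ y≤)
      where
      coverLength≡ : ∀ Cs → coverLength G Cs ≡ sum (map ‖_‖ Cs)
      coverLength≡ []       = refl
      coverLength≡ (C ∷ Cs) = cong₂ _+_ (sym (count⟨true⟩ C)) (coverLength≡ Cs)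

    covers-from-pair : ∀ {D D'} → IsEvenCycle G D → IsEvenCycle G D' → CoversWithCore D D' →
                       3 * (‖ D ‖ + ‖ D' ‖) ≤ 2 * (2 * ‖ A ‖ + 2 * ‖ B ‖) →
                       HasShortEvenCover G 4 k × (IsCycle G Core → HasShortEvenCover G 3 k)
    covers-from-pair {D} {D'} D-even D'-even covering short =
      evenCover {k = k} (D ∷ D' ∷ Y₁ ∷ Y₂ ∷ []) (D-even ∷ D'-even ∷ Y₁-even ∷ Y₂-even ∷ [])
                (λ e → via-Y (D e) (D' e) (Core⊆Y₁∪Y₂ e) (covering e)) ≤-refl
                (short-cover {‖ D ‖ + ‖ D' ‖} (D ∷ D' ∷ Y₁ ∷ Y₂ ∷ []) (regroup₄ (‖ D ‖) (‖ D' ‖) (‖ Y₁ ‖) (‖ Y₂ ‖)) short (≤-reflexive ‖Y₁‖+‖Y₂‖)) ,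
      λ Core-cycle →
      evenCover {k = k} (D ∷ D' ∷ Core ∷ []) (D-even ∷ D'-even ∷ Core-cycle⇒even (λ _ → id) Core-cycle ∷ [])
                covering ≤-refl
                (short-cover {‖ D ‖ + ‖ D' ‖} (D ∷ D' ∷ Core ∷ []) (regroup₃ (‖ D ‖) (‖ D' ‖) (‖ Core ‖)) short
                             (subst (_≤ ‖ T ‖ + (‖ T ‖ + (‖ B ‖ + ‖ U ‖))) (sym ‖Core‖) (m≤n+m _ (‖ T ‖))))
      where
      via-Y : ∀ a b {c d} → (c ≡ true → d ≡ true) → (a ∨ (b ∨ (c ∨ false))) ≡ true → (a ∨ (b ∨ d)) ≡ true
      via-Y true  _     _   _ = refl
      via-Y false true  _   _ = refl
      via-Y false false c⇒d c = c⇒d (trans (sym (∨-identityʳ _)) c)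
      regroup₄ : ∀ p q r s → p + (q + (r + (s + 0))) ≡ p + q + (r + s)
      regroup₄ = solve-∀
      regroup₃ : ∀ p q r → p + (q + (r + 0)) ≡ p + q + r
      regroup₃ = solve-∀

    covers : HasShortEvenCover G 4 k × (IsCycle G Core → HasShortEvenCover G 3 k)
    covers with two-of-three (‖ M₁ ∆ M₂ ‖) (‖ M₁ ∆ M₃ ‖) (‖ M₂ ∆ M₃ ‖)
    ... | inj₁ short        = covers-from-pair (∆-even M₁-factor M₂-factor) (∆-even M₁-factor M₃-factor) cover₁₂₋₁₃ (by-class short)
    ... | inj₂ (inj₁ short) = covers-from-pair (∆-even M₁-factor M₂-factor) (∆-even M₂-factor M₃-factor) cover₁₂₋₂₃ (by-class short)
    ... | inj₂ (inj₂ short) = covers-from-pair (∆-even M₁-factor M₃-factor) (∆-even M₂-factor M₃-factor) cover₁₃₋₂₃ (by-class short)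

mainTheorem12 : (k : ℕ) (G : Graph) → Cubic G →
    (M₁ M₂ M₃ : EdgeSet G) →
    OneFactor G M₁ → OneFactor G M₂ → OneFactor G M₃ →
    ¬ SameSet G M₁ M₂ → ¬ SameSet G M₁ M₃ → ¬ SameSet G M₂ M₃ →
    size G (coreU G M₁ M₂ M₃) ≡ k →
    Bipartite G (coreEdges G M₁ M₂ M₃) →
    HasShortEvenCover G 4 k
    × (IsCycle G (coreEdges G M₁ M₂ M₃) → HasShortEvenCover G 3 k)
mainTheorem12 k G cubic M₁ M₂ M₃ M₁-factor M₂-factor M₃-factor _ _ _ size-U≡k (c , Core-proper) =
  CoreCover.covers G cubic M₁ M₂ M₃ M₁-factor M₂-factor M₃-factor c Core-proper k size-U≡k
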